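{- Let $k\ge 2$ and $N\ge 2$ be integers, let $T_{\mathrm{count}} = N^k T$ be the Holte count matrix of $k$-summand base-$N$ addition, and let $\widetilde{T}_{\mathrm{count}}$ be its leading $(k-1)\times(k-1)$ principal submatrix (indices $0,\ldots,k-2$). Then \[ \chi_{\widetilde{T}_{\mathrm{count}}}(\lambda) = \frac{1}{k!}\sum_{j=0}^{k-1}|s(k,k-j)|\prod_{\substack{i=0\\ i\ne j}}^{k-1}\bigl(\lambda - N^{k-i}\bigr), \] equivalently \[ \frac{\chi_{\widetilde{T}_{\mathrm{count}}}(\lambda)}{\chi_{T_{\mathrm{count}}}(\lambda)} = \sum_{j=0}^{k-1}\frac{c_{k,j}}{\lambda - N^{k-j}},\qquad c_{k,j} = \frac{|s(k,k-j)|}{k!}. \]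
   Context: Let $d_1,\ldots,d_k$ be independent and uniform on $\{0,\ldots,N-1\}$. The Holte matrix $T$ is the $k\times k$ matrix with $T[c',c] = N^{ -k}\#\{(d_1,\ldots,d_k)\in\{0,\ldots,N-1\}^k : \lfloor (d_1+\cdots+d_k+c)/N\rfloor = c'\}$, $c,c'\in\{0,\ldots,k-1\}$; so $T_{\mathrm{count}}[c',c]$ is the number of such digit tuples. For a square matrix $M$, $\chi_M(\lambda)=\det(\lambda I - M)$. $|s(k,m)|$ is the unsigned Stirling number of the first kind, $x(x+1)\cdots(x+k-1) = \sum_m|s(k,m)|x^m$. -}

module Defs where

open import Data.Nat as ℕ using (ℕ; zero; suc; NonZero; _∸_; _^_)
open import Data.Nat.DivMod using (_/_)

open import Data.Integer as ℤ using (ℤ; +_)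
open import Data.Fin using (Fin; toℕ; punchIn)
import Data.Fin as Fin
open import Data.List using (List; []; _∷_; map; concatMap; upTo; length; filter)
open import Data.Nat.ListAction using (sum)
open import Data.Bool using (if_then_else_)
open import Relation.Nullary.Decidable using (⌊_⌋)
open import Data.Nat using (_≟_)

tuples : ℕ → ℕ → List (List ℕ)
tuples zero    N = [] ∷ []
tuples (suc k) N = concatMap (λ d → map (d ∷_) (tuples k N)) (upTo N)

Tcount : (k N : ℕ) .{{_ : NonZero N}} → ℕ → ℕ → ℕ
Tcount k N c' c = length (filter (λ d → ((sum d ℕ.+ c) / N) ≟ c') (tuples k N))

Ttilde : (k N : ℕ) .{{_ : NonZero N}} → Fin (k ∸ 1) → Fin (k ∸ 1) → ℤ
Ttilde k N i j = + Tcount k N (toℕ i) (toℕ j)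

Tfull : (k N : ℕ) .{{_ : NonZero N}} → Fin k → Fin k → ℤ
Tfull k N i j = + Tcount k N (toℕ i) (toℕ j)

sumFin : (n : ℕ) → (Fin n → ℤ) → ℤ
sumFin zero    f = + 0
sumFin (suc n) f = f Fin.zero ℤ.+ sumFin n (λ i → f (Fin.suc i))

sumTo : ℕ → (ℕ → ℤ) → ℤ
sumTo zero    f = + 0
sumTo (suc n) f = sumTo n f ℤ.+ f n

prodTo : ℕ → (ℕ → ℤ) → ℤ
prodTo zero    f = + 1
prodTo (suc n) f = prodTo n f ℤ.* f n

sign : ℕ → ℤ
sign zero    = + 1
sign (suc n) = ℤ.- sign n

det : (n : ℕ) → (Fin n → Fin n → ℤ) → ℤ
det zero    M = + 1
det (suc n) M = sumFin (suc n) (λ j →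
  sign (toℕ j) ℤ.* M Fin.zero j ℤ.* det n (λ r c → M (Fin.suc r) (punchIn j c)))

charPoly : (n : ℕ) → (Fin n → Fin n → ℤ) → ℤ → ℤ
charPoly n M x = det n (λ i j → (if ⌊ i Fin.≟ j ⌋ then x else + 0) ℤ.- M i j)

-- unsigned Stirling numbers of the first kind: coefficients of x(x+1)…(x+n-1);
-- multiplying by (x+n) gives |s(n+1,m)| = n|s(n,m)| + |s(n,m-1)|
stirling1 : ℕ → ℕ → ℕ
stirling1 zero    zero    = 1
stirling1 zero    (suc m) = 0
stirling1 (suc n) zero    = n ℕ.* stirling1 n zero
stirling1 (suc n) (suc m) = n ℕ.* stirling1 n (suc m) ℕ.+ stirling1 n m

-- Write f c (x) = (x + c) (x + c - 1) ⋯ (x + c - k + 1) = k! C(x + c, k). Summing over all k-digit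
-- tuples t, ∑ₜ C(⌊(Σt + n) / N⌋, k) = C(n, k); for n = N x + c the carry is x + ⌊(Σt + c) / N⌋, so
-- grouping the tuples by carry gives f c (N x) = ∑_{c′ < k} T[c′, c] f c′ (x). The last row
-- T[k - 1, c] = C(N + c, k) multiplies the rising factorial f (k - 1) (x) = ∑ₘ |s(k, m)| xᵐ, so
-- comparing coefficients of xᵐ for m = k, …, 2 shows that P[t, c] = [x^(k-t)] f c satisfies
-- P T̃ = D P - s ⊗ T[k - 1, ·], with D = diag(N^(k-t)) and s t = |s(k, k - t)|. Evaluating f c at 1
-- and at N rewrites k! T[k - 1, c] as ∑ₜ P[t, c] (N^(k-t) - N), so k! P T̃ = (k! D - s vᵀ) P with
-- v t = N^(k-t) - N. Vandermonde's identity factors P as a triangular matrix times the Pascal matrix,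
-- so P is invertible and k!^(k-1) χ_T̃(x) = det (k! (x - D) + s vᵀ), which the matrix determinant
-- lemma evaluates; ∑ₘ |s(k, m)| = k! then gives the stated sum.

module Submission where

open import Data.Bool using (true; false; if_then_else_)
open import Function using (_∘_)
open import Relation.Binary.PropositionalEquality
open import Relation.Nullary.Decidable using (⌊_⌋)
open import Defs

-- Binomial coefficients, digit tuples and carries

module _ where
  open import Data.List using (List; []; _∷_; map; concatMap; upTo; applyUpTo; length; filter; _++_)
  open import Data.List.Properties using (map-++; map-cong; map-∘)
  open import Data.Nat
  open import Data.Nat.Combinatorics using (_C_; nCn≡1; nC1≡n; k>n⇒nCk≡0; nCk+nC[k+1]≡[n+1]C[k+1])
  open import Data.Nat.DivMod
  open import Data.Nat.Divisibility using (∣-refl; m∣m*n)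
  open import Data.Nat.ListAction using (sum)
  open import Data.Nat.ListAction.Properties using (sum-++)
  open import Data.Nat.Properties
  open import Data.Nat.Solver using (module +-*-Solver)
  open import Relation.Nullary using (Dec; does)
  open import Algebra.Properties.CommutativeSemigroup +-commutativeSemigroup using (interchange)
  open +-*-Solver using (solve; _:+_; _:*_; _:=_; con)

  C-pascal : ∀ n k → suc n C suc k ≡ n C k + n C suc k
  C-pascal n k = sym (nCk+nC[k+1]≡[n+1]C[k+1] n k)

  C-absorb : ∀ n k → suc k * (suc n C suc k) ≡ suc n * (n C k)
  C-absorb zero    zero    = refl
  C-absorb zero    (suc k) = *-zeroʳ (suc (suc k))
  C-absorb (suc n) zero    = trans (*-identityˡ _) (trans (nC1≡n (suc (suc n))) (sym (*-identityʳ _)))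
  C-absorb (suc n) (suc k) = begin
    suc (suc k) * (suc (suc n) C suc (suc k))
      ≡⟨ cong (suc (suc k) *_) (C-pascal (suc n) (suc k)) ⟩
    suc (suc k) * (a + b)
      ≡⟨ solve 3 (λ k a b → (con 2 :+ k) :* (a :+ b) := ((con 1 :+ k) :* a :+ a) :+ (con 2 :+ k) :* b) refl k a b ⟩
    (suc k * a + a) + suc (suc k) * b
      ≡⟨ cong₂ (λ u v → (u + a) + v) (C-absorb n k) (C-absorb n (suc k)) ⟩
    (suc n * (n C k) + a) + suc n * (n C suc k)
      ≡⟨ solve 4 (λ n c d a → ((con 1 :+ n) :* c :+ a) :+ (con 1 :+ n) :* d := a :+ (con 1 :+ n) :* (c :+ d)) refl n (n C k) (n C suc k) a ⟩
    a + suc n * (n C k + n C suc k)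
      ≡⟨ cong (λ z → a + suc n * z) (sym (C-pascal n k)) ⟩
    suc (suc n) * (suc n C suc k) ∎
    where
    open ≡-Reasoning
    a = suc n C suc k
    b = suc n C suc (suc k)

  C-pos : ∀ n k → k ≤ n → 0 < n C k
  C-pos n       zero    _         = z<s
  C-pos (suc n) (suc k) (s≤s k≤n) = begin-strict
    0                     <⟨ C-pos n k k≤n ⟩
    n C k                 ≤⟨ m≤m+n (n C k) (n C suc k) ⟩
    n C k + n C suc k     ≡⟨ C-pascal n k ⟨
    suc n C suc k         ∎
    where open ≤-Reasoning

  sumBelow : ℕ → (ℕ → ℕ) → ℕ
  sumBelow zero    g = 0
  sumBelow (suc n) g = g 0 + sumBelow n (g ∘ suc)

  sumBelow-cong : ∀ n {g h : ℕ → ℕ} → (∀ i → i < n → g i ≡ h i) → sumBelow n g ≡ sumBelow n h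
  sumBelow-cong zero    g≗h = refl
  sumBelow-cong (suc n) g≗h = cong₂ _+_ (g≗h 0 z<s) (sumBelow-cong n (λ i i<n → g≗h (suc i) (s<s i<n)))

  sumBelow-zero : ∀ n {g : ℕ → ℕ} → (∀ i → i < n → g i ≡ 0) → sumBelow n g ≡ 0
  sumBelow-zero zero    g≗0 = refl
  sumBelow-zero (suc n) g≗0 = cong₂ _+_ (g≗0 0 z<s) (sumBelow-zero n (λ i i<n → g≗0 (suc i) (s<s i<n)))

  sumBelow-snoc : ∀ n (g : ℕ → ℕ) → sumBelow (suc n) g ≡ sumBelow n g + g n
  sumBelow-snoc zero    g = +-comm (g 0) 0
  sumBelow-snoc (suc n) g = trans (cong (g 0 +_) (sumBelow-snoc n (g ∘ suc))) (sym (+-assoc (g 0) _ _))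

  sumBelow-+ : ∀ n (g h : ℕ → ℕ) → sumBelow n (λ i → g i + h i) ≡ sumBelow n g + sumBelow n h
  sumBelow-+ zero    g h = refl
  sumBelow-+ (suc n) g h = begin
    (g 0 + h 0) + sumBelow n (λ i → g (suc i) + h (suc i))      ≡⟨ cong ((g 0 + h 0) +_) (sumBelow-+ n (g ∘ suc) (h ∘ suc)) ⟩
    (g 0 + h 0) + (sumBelow n (g ∘ suc) + sumBelow n (h ∘ suc)) ≡⟨ interchange (g 0) (h 0) _ _ ⟩
    (g 0 + sumBelow n (g ∘ suc)) + (h 0 + sumBelow n (h ∘ suc)) ∎
    where open ≡-Reasoning

  sumBelow-truncate : ∀ m d (g : ℕ → ℕ) → (∀ i → m ≤ i → g i ≡ 0) → sumBelow (m + d) g ≡ sumBelow m g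
  sumBelow-truncate m zero    g g≗0 = cong (λ n → sumBelow n g) (+-identityʳ m)
  sumBelow-truncate m (suc d) g g≗0 = begin
    sumBelow (m + suc d) g         ≡⟨ cong (λ n → sumBelow n g) (+-suc m d) ⟩
    sumBelow (suc (m + d)) g       ≡⟨ sumBelow-snoc (m + d) g ⟩
    sumBelow (m + d) g + g (m + d) ≡⟨ cong₂ _+_ (sumBelow-truncate m d g g≗0) (g≗0 (m + d) (m≤m+n m d)) ⟩
    sumBelow m g + 0               ≡⟨ +-identityʳ _ ⟩
    sumBelow m g                   ∎
    where open ≡-Reasoning

  C-vandermonde : ∀ c x k → (x + c) C k ≡ sumBelow (suc k) (λ i → (c C i) * (x C (k ∸ i)))
  C-vandermonde zero    x k = begin
    (x + 0) C k                                           ≡⟨ cong (_C k) (+-identityʳ x) ⟩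
    x C k                                                 ≡⟨ +-identityʳ (x C k) ⟨
    x C k + 0                                             ≡⟨ cong₂ _+_ (+-identityʳ (x C k)) (sumBelow-zero k (λ _ _ → refl)) ⟨
    (x C k + 0) + sumBelow k (λ i → 0 * (x C (k ∸ suc i))) ∎
    where open ≡-Reasoning
  C-vandermonde (suc c) x zero    = refl
  C-vandermonde (suc c) x (suc k) = begin
    (x + suc c) C suc k                       ≡⟨ cong (_C suc k) (+-suc x c) ⟩
    suc (x + c) C suc k                       ≡⟨ C-pascal (x + c) k ⟩
    (x + c) C k + (x + c) C suc k             ≡⟨ cong₂ _+_ (C-vandermonde c x k) (C-vandermonde c x (suc k)) ⟩
    S₁ + (1 * (x C suc k) + S₂)               ≡⟨ solve 3 (λ a b c → a :+ (con 1 :* b :+ c) := con 1 :* b :+ (a :+ c)) refl S₁ (x C suc k) S₂ ⟩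
    1 * (x C suc k) + (S₁ + S₂)               ≡⟨ cong (1 * (x C suc k) +_) (sumBelow-+ (suc k) (λ i → (c C i) * (x C (k ∸ i))) (λ i → (c C suc i) * (x C (k ∸ i)))) ⟨
    1 * (x C suc k) + sumBelow (suc k) (λ i → (c C i) * (x C (k ∸ i)) + (c C suc i) * (x C (k ∸ i)))
      ≡⟨ cong (1 * (x C suc k) +_) (sumBelow-cong (suc k) (λ i _ → step i)) ⟩
    sumBelow (suc (suc k)) (λ i → (suc c C i) * (x C (suc k ∸ i))) ∎
    where
    open ≡-Reasoning
    S₁ = sumBelow (suc k) (λ i → (c C i) * (x C (k ∸ i)))
    S₂ = sumBelow (suc k) (λ i → (c C suc i) * (x C (k ∸ i)))
    step : ∀ i → (c C i) * (x C (k ∸ i)) + (c C suc i) * (x C (k ∸ i)) ≡ (suc c C suc i) * (x C (k ∸ i))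
    step i = trans (sym (*-distribʳ-+ (x C (k ∸ i)) (c C i) (c C suc i))) (cong (_* (x C (k ∸ i))) (sym (C-pascal c i)))

  sum-map-concatMap : ∀ {A B : Set} (f : B → ℕ) (g : A → List B) xs →
    sum (map f (concatMap g xs)) ≡ sum (map (λ x → sum (map f (g x))) xs)
  sum-map-concatMap f g []       = refl
  sum-map-concatMap f g (x ∷ xs) = begin
    sum (map f (g x ++ concatMap g xs))         ≡⟨ cong sum (map-++ f (g x) (concatMap g xs)) ⟩
    sum (map f (g x) ++ map f (concatMap g xs)) ≡⟨ sum-++ (map f (g x)) _ ⟩
    sum (map f (g x)) + sum (map f (concatMap g xs)) ≡⟨ cong (sum (map f (g x)) +_) (sum-map-concatMap f g xs) ⟩
    sum (map f (g x)) + sum (map (λ y → sum (map f (g y))) xs) ∎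
    where open ≡-Reasoning

  sum-map-applyUpTo : ∀ (f h : ℕ → ℕ) n → sum (map f (applyUpTo h n)) ≡ sumBelow n (f ∘ h)
  sum-map-applyUpTo f h zero    = refl
  sum-map-applyUpTo f h (suc n) = cong (f (h 0) +_) (sum-map-applyUpTo f (h ∘ suc) n)

  sum-map-+ : ∀ {A : Set} (f g : A → ℕ) xs → sum (map (λ x → f x + g x) xs) ≡ sum (map f xs) + sum (map g xs)
  sum-map-+ f g []       = refl
  sum-map-+ f g (x ∷ xs) = begin
    (f x + g x) + sum (map (λ y → f y + g y) xs)   ≡⟨ cong ((f x + g x) +_) (sum-map-+ f g xs) ⟩
    (f x + g x) + (sum (map f xs) + sum (map g xs)) ≡⟨ interchange (f x) (g x) _ _ ⟩
    (f x + sum (map f xs)) + (g x + sum (map g xs)) ∎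
    where open ≡-Reasoning

  sum-map-sumBelow : ∀ {A : Set} n (f : A → ℕ → ℕ) xs →
    sum (map (λ x → sumBelow n (f x)) xs) ≡ sumBelow n (λ i → sum (map (λ x → f x i) xs))
  sum-map-sumBelow n f []       = sym (sumBelow-zero n (λ _ _ → refl))
  sum-map-sumBelow n f (x ∷ xs) = begin
    sumBelow n (f x) + sum (map (λ y → sumBelow n (f y)) xs)    ≡⟨ cong (sumBelow n (f x) +_) (sum-map-sumBelow n f xs) ⟩
    sumBelow n (f x) + sumBelow n (λ i → sum (map (λ y → f y i) xs)) ≡⟨ sumBelow-+ n (f x) _ ⟨
    sumBelow n (λ i → f x i + sum (map (λ y → f y i) xs))           ∎
    where open ≡-Reasoning

  sum-map-tuples : ∀ k N (f : List ℕ → ℕ) →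
    sum (map f (tuples (suc k) N)) ≡ sum (map (λ t → sumBelow N (λ d → f (d ∷ t))) (tuples k N))
  sum-map-tuples k N f = begin
    sum (map f (concatMap (λ d → map (d ∷_) (tuples k N)) (upTo N)))
      ≡⟨ sum-map-concatMap f _ (upTo N) ⟩
    sum (map (λ d → sum (map f (map (d ∷_) (tuples k N)))) (upTo N))
      ≡⟨ cong sum (map-cong (λ d → cong sum (sym (map-∘ (tuples k N)))) (upTo N)) ⟩
    sum (map (λ d → sum (map (λ t → f (d ∷ t)) (tuples k N))) (upTo N))
      ≡⟨ sum-map-applyUpTo _ (λ d → d) N ⟩
    sumBelow N (λ d → sum (map (λ t → f (d ∷ t)) (tuples k N)))
      ≡⟨ sum-map-sumBelow N (λ t d → f (d ∷ t)) (tuples k N) ⟨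
    sum (map (λ t → sumBelow N (λ d → f (d ∷ t))) (tuples k N)) ∎
    where open ≡-Reasoning

  sum-map-zero : ∀ {A : Set} (xs : List A) → sum (map (λ _ → 0) xs) ≡ 0
  sum-map-zero []       = refl
  sum-map-zero (x ∷ xs) = sum-map-zero xs

  digit-bound : ∀ {N k} d t → d < N → sum t + k ≤ k * N → (d + sum t) + suc k ≤ suc k * N
  digit-bound {N} {k} d t d<N bound = begin
    (d + sum t) + suc k   ≡⟨ +-suc (d + sum t) k ⟩
    suc ((d + sum t) + k) ≡⟨ cong suc (+-assoc d (sum t) k) ⟩
    suc d + (sum t + k)   ≤⟨ +-mono-≤ d<N bound ⟩
    N + k * N             ∎
    where open ≤-Reasoning

  -- The bound sum t + k ≤ k * N says sum t ≤ k (N - 1) without truncated subtraction.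
  sum-map-tuples-cong : ∀ k N (f g : List ℕ → ℕ) → (∀ t → sum t + k ≤ k * N → f t ≡ g t) →
    sum (map f (tuples k N)) ≡ sum (map g (tuples k N))
  sum-map-tuples-cong zero    N f g f≗g = cong (_+ 0) (f≗g [] z≤n)
  sum-map-tuples-cong (suc k) N f g f≗g = begin
    sum (map f (tuples (suc k) N))                              ≡⟨ sum-map-tuples k N f ⟩
    sum (map (λ t → sumBelow N (λ d → f (d ∷ t))) (tuples k N)) ≡⟨ sum-map-tuples-cong k N _ _ (λ t bound →
        sumBelow-cong N (λ d d<N → f≗g (d ∷ t) (digit-bound d t d<N bound))) ⟩
    sum (map (λ t → sumBelow N (λ d → g (d ∷ t))) (tuples k N)) ≡⟨ sum-map-tuples k N g ⟨
    sum (map g (tuples (suc k) N))                              ∎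
    where open ≡-Reasoning

  indicator : ∀ {P : Set} → Dec P → ℕ
  indicator d = if does d then 1 else 0

  sumBelow-indicator : ∀ K (h : ℕ → ℕ) m → m < K → sumBelow K (λ c → h c * indicator (m ≟ c)) ≡ h m
  sumBelow-indicator (suc K) h zero    _ = begin
    h 0 * 1 + sumBelow K (λ c → h (suc c) * 0) ≡⟨ cong₂ _+_ (*-identityʳ (h 0)) (sumBelow-zero K (λ c _ → *-zeroʳ (h (suc c)))) ⟩
    h 0 + 0                                    ≡⟨ +-identityʳ (h 0) ⟩
    h 0                                        ∎
    where open ≡-Reasoning
  sumBelow-indicator (suc K) h (suc m) (s≤s m<K) = begin
    h 0 * 0 + sumBelow K (λ c → h (suc c) * indicator (m ≟ c)) ≡⟨ cong (_+ sumBelow K (λ c → h (suc c) * indicator (m ≟ c))) (*-zeroʳ (h 0)) ⟩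
    0 + sumBelow K (λ c → h (suc c) * indicator (m ≟ c))       ≡⟨ sumBelow-indicator K (h ∘ suc) m m<K ⟩
    h (suc m)                                                   ∎
    where open ≡-Reasoning

  length-filter-∷ : ∀ (κ : List ℕ → ℕ) c t L →
    length (filter (λ u → κ u ≟ c) (t ∷ L)) ≡ indicator (κ t ≟ c) + length (filter (λ u → κ u ≟ c) L)
  length-filter-∷ κ c t L with does (κ t ≟ c)
  ... | true  = refl
  ... | false = refl

  sum-map-by-value : ∀ (κ : List ℕ → ℕ) K (h : ℕ → ℕ) (L : List (List ℕ)) →
    sum (map (λ t → sumBelow K (λ c → h c * indicator (κ t ≟ c))) L) ≡ sumBelow K (λ c → h c * length (filter (λ u → κ u ≟ c) L))
  sum-map-by-value κ K h []      = sym (sumBelow-zero K (λ c _ → *-zeroʳ (h c)))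
  sum-map-by-value κ K h (t ∷ L) = begin
    sumBelow K (λ c → h c * indicator (κ t ≟ c)) + sum (map (λ u → sumBelow K (λ c → h c * indicator (κ u ≟ c))) L)
      ≡⟨ cong (sumBelow K (λ c → h c * indicator (κ t ≟ c)) +_) (sum-map-by-value κ K h L) ⟩
    sumBelow K (λ c → h c * indicator (κ t ≟ c)) + sumBelow K (λ c → h c * length (filter (λ u → κ u ≟ c) L))
      ≡⟨ sumBelow-+ K _ _ ⟨
    sumBelow K (λ c → h c * indicator (κ t ≟ c) + h c * length (filter (λ u → κ u ≟ c) L))
      ≡⟨ sumBelow-cong K (λ c _ → trans (sym (*-distribˡ-+ (h c) _ _)) (cong (h c *_) (sym (length-filter-∷ κ c t L)))) ⟩
    sumBelow K (λ c → h c * length (filter (λ u → κ u ≟ c) (t ∷ L))) ∎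
    where open ≡-Reasoning

  module _ (N : ℕ) .{{_ : NonZero N}} where

    carry : ℕ → List ℕ → ℕ
    carry c t = (sum t + c) / N

    -- Summing over the first digit telescopes, since the carry rises by one every N steps.
    sum-digit-C-carry : ∀ k n t → sumBelow N (λ d → carry (suc n) (d ∷ t) C suc k)
                                ≡ sumBelow N (λ d → carry n (d ∷ t) C suc k) + carry n t C k
    sum-digit-C-carry k n t = +-cancelʳ-≡ (h M) _ _ (begin
      sumBelow N (λ d → h ((d + sum t) + suc n)) + h M ≡⟨ cong (_+ h M) (sumBelow-cong N (λ d _ → cong h (shift d))) ⟩
      sumBelow N (λ d → h (suc d + M)) + h M           ≡⟨ +-comm _ (h M) ⟩
      sumBelow (suc N) (λ d → h (d + M))               ≡⟨ sumBelow-snoc N (λ d → h (d + M)) ⟩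
      sumBelow N (λ d → h (d + M)) + h (N + M)         ≡⟨ cong (λ z → sumBelow N (λ d → h (d + M)) + z C suc k) [N+M]/N≡1+M/N ⟩
      sumBelow N (λ d → h (d + M)) + suc (M / N) C suc k ≡⟨ cong (sumBelow N (λ d → h (d + M)) +_) (C-pascal (M / N) k) ⟩
      sumBelow N (λ d → h (d + M)) + ((M / N) C k + h M) ≡⟨ +-assoc (sumBelow N (λ d → h (d + M))) _ _ ⟨
      sumBelow N (λ d → h (d + M)) + (M / N) C k + h M   ≡⟨ cong (λ s → s + (M / N) C k + h M) (sumBelow-cong N (λ d _ → cong h (sym (+-assoc d (sum t) n)))) ⟩
      sumBelow N (λ d → h ((d + sum t) + n)) + (M / N) C k + h M ∎)
      where
      open ≡-Reasoning
      M = sum t + n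
      h : ℕ → ℕ
      h m = (m / N) C suc k
      shift : ∀ d → (d + sum t) + suc n ≡ suc d + M
      shift d = trans (+-assoc d (sum t) (suc n)) (trans (cong (d +_) (+-suc (sum t) n)) (+-suc d M))
      [N+M]/N≡1+M/N : (N + M) / N ≡ suc (M / N)
      [N+M]/N≡1+M/N = trans (+-distrib-/-∣ˡ M (∣-refl {N})) (cong (_+ M / N) (n/n≡1 N))

    sum-C-carry : ∀ k n → sum (map (λ t → carry n t C k) (tuples k N)) ≡ n C k
    sum-C-carry zero    n       = refl
    sum-C-carry (suc k) zero    = trans (sum-map-tuples-cong (suc k) N _ (λ _ → 0) carry-small) (sum-map-zero (tuples (suc k) N))
      where
      carry-small : ∀ t → sum t + suc k ≤ suc k * N → carry 0 t C suc k ≡ 0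
      carry-small t bound = k>n⇒nCk≡0 (m<n*o⇒m/o<n (begin-strict
        sum t + 0     ≡⟨ +-identityʳ (sum t) ⟩
        sum t         <⟨ m<m+n (sum t) z<s ⟩
        sum t + suc k ≤⟨ bound ⟩
        suc k * N     ∎))
        where open ≤-Reasoning
    sum-C-carry (suc k) (suc n) = begin
      sum (map (λ t → carry (suc n) t C suc k) (tuples (suc k) N))
        ≡⟨ sum-map-tuples k N _ ⟩
      sum (map (λ t → sumBelow N (λ d → carry (suc n) (d ∷ t) C suc k)) (tuples k N))
        ≡⟨ cong sum (map-cong (sum-digit-C-carry k n) (tuples k N)) ⟩
      sum (map (λ t → sumBelow N (λ d → carry n (d ∷ t) C suc k) + carry n t C k) (tuples k N))
        ≡⟨ sum-map-+ _ _ (tuples k N) ⟩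
      sum (map (λ t → sumBelow N (λ d → carry n (d ∷ t) C suc k)) (tuples k N)) + sum (map (λ t → carry n t C k) (tuples k N))
        ≡⟨ cong₂ _+_ (sum-map-tuples k N _) (sym (sum-C-carry k n)) ⟨
      sum (map (λ t → carry n t C suc k) (tuples (suc k) N)) + n C k
        ≡⟨ cong (_+ n C k) (sum-C-carry (suc k) n) ⟩
      n C suc k + n C k                         ≡⟨ +-comm (n C suc k) (n C k) ⟩
      n C k + n C suc k                         ≡⟨ C-pascal n k ⟨
      suc n C suc k                             ∎
      where open ≡-Reasoning

    sum-map-carry : ∀ k c (h : ℕ → ℕ) → c < k →
      sum (map (λ t → h (carry c t)) (tuples k N)) ≡ sumBelow k (λ c′ → h c′ * Tcount k N c′ c)
    sum-map-carry k c h c<k =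
      trans (sum-map-tuples-cong k N _ _ by-value) (sum-map-by-value (carry c) k h (tuples k N))
      where
      by-value : ∀ t → sum t + k ≤ k * N → h (carry c t) ≡ sumBelow k (λ c′ → h c′ * indicator (carry c t ≟ c′))
      by-value t bound = sym (sumBelow-indicator k h _ (m<n*o⇒m/o<n (<-≤-trans (+-monoʳ-< (sum t) c<k) bound)))

    binomial-eigen : ∀ k x c → c < k → (N * x + c) C k ≡ sumBelow k (λ c′ → ((x + c′) C k) * Tcount k N c′ c)
    binomial-eigen k x c c<k = begin
      (N * x + c) C k                                              ≡⟨ sum-C-carry k (N * x + c) ⟨
      sum (map (λ t → carry (N * x + c) t C k) (tuples k N))       ≡⟨ cong sum (map-cong (λ t → cong (_C k) (carry-shift t)) (tuples k N)) ⟩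
      sum (map (λ t → (x + carry c t) C k) (tuples k N))           ≡⟨ sum-map-carry k c (λ c′ → (x + c′) C k) c<k ⟩
      sumBelow k (λ c′ → ((x + c′) C k) * Tcount k N c′ c)           ∎
      where
      open ≡-Reasoning
      carry-shift : ∀ t → carry (N * x + c) t ≡ x + carry c t
      carry-shift t = begin
        (sum t + (N * x + c)) / N   ≡⟨ cong (_/ N) (trans (cong (sum t +_) (+-comm (N * x) c)) (sym (+-assoc (sum t) c (N * x)))) ⟩
        ((sum t + c) + N * x) / N   ≡⟨ +-distrib-/-∣ʳ (sum t + c) (m∣m*n x) ⟩
        carry c t + (N * x) / N     ≡⟨ cong (carry c t +_) (trans (cong (_/ N) (*-comm N x)) (m*n/n≡m x N)) ⟩
        carry c t + x               ≡⟨ +-comm (carry c t) x ⟩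
        x + carry c t               ∎

    Tcount-last : ∀ k c → c < suc k → Tcount (suc k) N k c ≡ (N + c) C suc k
    Tcount-last k c c<k = sym (begin
      (N + c) C suc k                                                   ≡⟨ cong (λ m → (m + c) C suc k) (*-identityʳ N) ⟨
      (N * 1 + c) C suc k                                               ≡⟨ binomial-eigen (suc k) 1 c c<k ⟩
      sumBelow (suc k) (λ c′ → ((1 + c′) C suc k) * Tcount (suc k) N c′ c) ≡⟨ sumBelow-snoc k _ ⟩
      sumBelow k (λ c′ → ((1 + c′) C suc k) * Tcount (suc k) N c′ c) + (suc k C suc k) * Tcount (suc k) N k c
        ≡⟨ cong₂ _+_ (sumBelow-zero k (λ c′ c′<k → cong (_* Tcount (suc k) N c′ c) (k>n⇒nCk≡0 (s≤s c′<k))))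
                     (trans (cong (_* Tcount (suc k) N k c) (nCn≡1 (suc k))) (*-identityˡ _)) ⟩
      Tcount (suc k) N k c                                              ∎)
      where open ≡-Reasoning

-- Polynomials as coefficient lists

module _ where
  open import Data.Empty using (⊥-elim)
  open import Data.Fin as Fin using (Fin; zero; suc; toℕ)
  open import Data.Fin.Permutation using (reverse)
  open import Data.Fin.Properties using (opposite-prop; toℕ<n)
  open import Data.Integer using (ℤ; +_; _+_; _*_; -_; _-_; _^_; ∣_∣)
  open import Data.Integer.Properties
  open import Data.Integer.Solver using (module +-*-Solver)
  open import Data.List using (List; []; _∷_)
  open import Data.Nat as ℕ using (ℕ; _!)
  import Data.Nat.Properties as ℕ
  open import Data.Nat.Combinatorics using (_C_; nCn≡1; nC1≡n)
  open import Data.Sum using (inj₁; inj₂)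
  open import Algebra.Properties.CommutativeSemigroup ℕ.*-commutativeSemigroup using (x∙yz≈y∙xz)
  open import Algebra.Properties.Semiring.Sum +-*-semiring using (sum-syntax; sum-cong-≗; sum-replicate-zero; *-distribˡ-sum; ∑-permute)
  open +-*-Solver using (solve; _:+_; _:*_; _:-_; :-_; _:=_; con)

  Poly : Set
  Poly = List ℤ

  eval : Poly → ℤ → ℤ
  eval []      x = + 0
  eval (a ∷ p) x = a + x * eval p x

  coeff : Poly → ℕ → ℤ
  coeff []      m         = + 0
  coeff (a ∷ p) ℕ.zero    = a
  coeff (a ∷ p) (ℕ.suc m) = coeff p m

  infixl 6 _⊕_
  _⊕_ : Poly → Poly → Poly
  []      ⊕ q       = q
  (a ∷ p) ⊕ []      = a ∷ p
  (a ∷ p) ⊕ (b ∷ q) = (a + b) ∷ (p ⊕ q)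

  infixr 7 _⊛_
  _⊛_ : ℤ → Poly → Poly
  c ⊛ []      = []
  c ⊛ (a ∷ p) = c * a ∷ c ⊛ p

  X+_·_ : ℤ → Poly → Poly
  X+ a · p = a ⊛ p ⊕ (+ 0 ∷ p)

  dilate : ℤ → Poly → Poly
  dilate c []      = []
  dilate c (a ∷ p) = a ∷ c ⊛ dilate c p

  ∑ₚ : ∀ n → (Fin n → Poly) → Poly
  ∑ₚ ℕ.zero    f = []
  ∑ₚ (ℕ.suc n) f = f zero ⊕ ∑ₚ n (f ∘ suc)

  eval-⊕ : ∀ p q x → eval (p ⊕ q) x ≡ eval p x + eval q x
  eval-⊕ []      q       x = sym (+-identityˡ _)
  eval-⊕ (a ∷ p) []      x = sym (+-identityʳ _)
  eval-⊕ (a ∷ p) (b ∷ q) x = trans (cong (λ z → (a + b) + x * z) (eval-⊕ p q x))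
    (solve 5 (λ a b x u v → (a :+ b) :+ x :* (u :+ v) := (a :+ x :* u) :+ (b :+ x :* v)) refl a b x (eval p x) (eval q x))

  eval-⊛ : ∀ c p x → eval (c ⊛ p) x ≡ c * eval p x
  eval-⊛ c []      x = sym (*-zeroʳ c)
  eval-⊛ c (a ∷ p) x = trans (cong (λ z → c * a + x * z) (eval-⊛ c p x))
    (solve 4 (λ c a x u → c :* a :+ x :* (c :* u) := c :* (a :+ x :* u)) refl c a x (eval p x))

  eval-X+· : ∀ a p x → eval (X+ a · p) x ≡ (x + a) * eval p x
  eval-X+· a p x = trans (eval-⊕ (a ⊛ p) (+ 0 ∷ p) x) (trans (cong (_+ (+ 0 + x * eval p x)) (eval-⊛ a p x))
    (solve 3 (λ a x u → a :* u :+ (con (+ 0) :+ x :* u) := (x :+ a) :* u) refl a x (eval p x)))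

  eval-dilate : ∀ c p x → eval (dilate c p) x ≡ eval p (c * x)
  eval-dilate c []      x = refl
  eval-dilate c (a ∷ p) x = cong (_+_ a) (begin
    x * eval (c ⊛ dilate c p) x  ≡⟨ cong (x *_) (eval-⊛ c (dilate c p) x) ⟩
    x * (c * eval (dilate c p) x) ≡⟨ cong (λ z → x * (c * z)) (eval-dilate c p x) ⟩
    x * (c * eval p (c * x))      ≡⟨ solve 3 (λ x c u → x :* (c :* u) := (c :* x) :* u) refl x c (eval p (c * x)) ⟩
    c * x * eval p (c * x)        ∎)
    where open ≡-Reasoning

  eval-∑ₚ : ∀ n (f : Fin n → Poly) x → eval (∑ₚ n f) x ≡ ∑[ i < n ] eval (f i) x
  eval-∑ₚ ℕ.zero    f x = refl
  eval-∑ₚ (ℕ.suc n) f x = trans (eval-⊕ (f zero) _ x) (cong (_+_ (eval (f zero) x)) (eval-∑ₚ n (f ∘ suc) x))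

  coeff-⊕ : ∀ p q m → coeff (p ⊕ q) m ≡ coeff p m + coeff q m
  coeff-⊕ []      q       m         = sym (+-identityˡ _)
  coeff-⊕ (a ∷ p) []      ℕ.zero    = sym (+-identityʳ _)
  coeff-⊕ (a ∷ p) []      (ℕ.suc m) = sym (+-identityʳ _)
  coeff-⊕ (a ∷ p) (b ∷ q) ℕ.zero    = refl
  coeff-⊕ (a ∷ p) (b ∷ q) (ℕ.suc m) = coeff-⊕ p q m

  coeff-⊛ : ∀ c p m → coeff (c ⊛ p) m ≡ c * coeff p m
  coeff-⊛ c []      m         = sym (*-zeroʳ c)
  coeff-⊛ c (a ∷ p) ℕ.zero    = refl
  coeff-⊛ c (a ∷ p) (ℕ.suc m) = coeff-⊛ c p m

  coeff-X+·-zero : ∀ a p → coeff (X+ a · p) 0 ≡ a * coeff p 0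
  coeff-X+·-zero a p = trans (coeff-⊕ (a ⊛ p) (+ 0 ∷ p) 0) (trans (cong (_+ + 0) (coeff-⊛ a p 0)) (+-identityʳ _))

  coeff-X+·-suc : ∀ a p m → coeff (X+ a · p) (ℕ.suc m) ≡ a * coeff p (ℕ.suc m) + coeff p m
  coeff-X+·-suc a p m = trans (coeff-⊕ (a ⊛ p) (+ 0 ∷ p) (ℕ.suc m)) (cong (_+ coeff p m) (coeff-⊛ a p (ℕ.suc m)))

  coeff-dilate : ∀ c p m → coeff (dilate c p) m ≡ c ^ m * coeff p m
  coeff-dilate c []      m         = sym (*-zeroʳ (c ^ m))
  coeff-dilate c (a ∷ p) ℕ.zero    = sym (*-identityˡ a)
  coeff-dilate c (a ∷ p) (ℕ.suc m) = trans (coeff-⊛ c (dilate c p) m) (trans (cong (c *_) (coeff-dilate c p m)) (sym (*-assoc c (c ^ m) _)))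

  coeff-∑ₚ : ∀ n (f : Fin n → Poly) m → coeff (∑ₚ n f) m ≡ ∑[ i < n ] coeff (f i) m
  coeff-∑ₚ ℕ.zero    f m = refl
  coeff-∑ₚ (ℕ.suc n) f m = trans (coeff-⊕ (f zero) _ m) (cong (_+_ (coeff (f zero) m)) (coeff-∑ₚ n (f ∘ suc) m))

  -- A nonzero constant term a would be a multiple of the larger number ∣ a ∣ + 1 + a₀.
  eval≡0-beyond⇒coeff≡0 : ∀ (p : Poly) a₀ → (∀ x → eval p (+ (x ℕ.+ a₀)) ≡ + 0) → ∀ m → coeff p m ≡ + 0
  eval≡0-beyond⇒coeff≡0 []      a₀ roots m         = refl
  eval≡0-beyond⇒coeff≡0 (a ∷ q) a₀ roots ℕ.zero    = ∣i∣≡0⇒i≡0 ∣a∣≡0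
    where
    X = ℕ.suc ∣ a ∣ ℕ.+ a₀
    v = eval q (+ X)
    a≡-Xv : a ≡ - (+ X * v)
    a≡-Xv = begin
      a                               ≡⟨ solve 2 (λ a w → a := (a :+ w) :+ (:- w)) refl a (+ X * v) ⟩
      (a + + X * v) + - (+ X * v)     ≡⟨ cong (_+ - (+ X * v)) (roots (ℕ.suc ∣ a ∣)) ⟩
      + 0 + - (+ X * v)               ≡⟨ +-identityˡ _ ⟩
      - (+ X * v)                     ∎
      where open ≡-Reasoning
    ∣a∣≡X∣v∣ : ∣ a ∣ ≡ X ℕ.* ∣ v ∣
    ∣a∣≡X∣v∣ = trans (cong ∣_∣ a≡-Xv) (trans (∣-i∣≡∣i∣ (+ X * v)) (abs-* (+ X) v))
    ∣a∣≡0 : ∣ a ∣ ≡ 0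
    ∣a∣≡0 with ∣ v ∣ | ∣a∣≡X∣v∣
    ... | ℕ.zero  | eq = trans eq (ℕ.*-zeroʳ X)
    ... | ℕ.suc w | eq = ⊥-elim (ℕ.<-irrefl refl (ℕ.<-≤-trans (ℕ.≤-trans (ℕ.s≤s (ℕ.m≤m+n ∣ a ∣ a₀)) (ℕ.m≤m*n X (ℕ.suc w))) (ℕ.≤-reflexive (sym eq))))
  eval≡0-beyond⇒coeff≡0 (a ∷ q) a₀ roots (ℕ.suc m) = eval≡0-beyond⇒coeff≡0 q (ℕ.suc a₀) q-roots m
    where
    a≡0 : a ≡ + 0
    a≡0 = eval≡0-beyond⇒coeff≡0 (a ∷ q) a₀ roots 0
    q-roots : ∀ x → eval q (+ (x ℕ.+ ℕ.suc a₀)) ≡ + 0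
    q-roots x with i*j≡0⇒i≡0∨j≡0 (+ (ℕ.suc x ℕ.+ a₀)) (trans (sym (+-identityˡ _)) (trans (cong (_+ _) (sym a≡0)) (roots (ℕ.suc x))))
    ... | inj₁ ()
    ... | inj₂ eq = trans (cong (λ z → eval q (+ z)) (ℕ.+-suc x a₀)) eq

  eval≗⇒coeff≡ : ∀ (p q : Poly) → (∀ x → eval p (+ x) ≡ eval q (+ x)) → ∀ m → coeff p m ≡ coeff q m
  eval≗⇒coeff≡ p q p≗q m = begin
    coeff p m                                    ≡⟨ solve 2 (λ a b → a := (a :+ con (- + 1) :* b) :+ b) refl (coeff p m) (coeff q m) ⟩
    (coeff p m + - + 1 * coeff q m) + coeff q m  ≡⟨ cong (_+ coeff q m) difference≡0 ⟩
    + 0 + coeff q m                              ≡⟨ +-identityˡ _ ⟩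
    coeff q m                                    ∎
    where
    open ≡-Reasoning
    difference≡0 : coeff p m + - + 1 * coeff q m ≡ + 0
    difference≡0 = trans (sym (trans (coeff-⊕ p (- + 1 ⊛ q) m) (cong (_+_ (coeff p m)) (coeff-⊛ (- + 1) q m))))
      (eval≡0-beyond⇒coeff≡0 (p ⊕ - + 1 ⊛ q) 0 (λ x → begin
        eval (p ⊕ - + 1 ⊛ q) (+ (x ℕ.+ 0))                          ≡⟨ cong (λ y → eval (p ⊕ - + 1 ⊛ q) (+ y)) (ℕ.+-identityʳ x) ⟩
        eval (p ⊕ - + 1 ⊛ q) (+ x)                                  ≡⟨ trans (eval-⊕ p _ (+ x)) (cong (_+_ (eval p (+ x))) (eval-⊛ (- + 1) q (+ x))) ⟩
        eval p (+ x) + - + 1 * eval q (+ x)                          ≡⟨ cong (λ y → y + - + 1 * eval q (+ x)) (p≗q x) ⟩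
        eval q (+ x) + - + 1 * eval q (+ x)                          ≡⟨ solve 1 (λ a → a :+ con (- + 1) :* a := con (+ 0)) refl (eval q (+ x)) ⟩
        + 0                                                          ∎) m)

  eval≡0 : ∀ (p : Poly) → (∀ m → coeff p m ≡ + 0) → ∀ y → eval p y ≡ + 0
  eval≡0 []      p≗0 y = refl
  eval≡0 (a ∷ p) p≗0 y = trans (cong₂ _+_ (p≗0 0) (cong (y *_) (eval≡0 p (p≗0 ∘ ℕ.suc) y))) (trans (+-identityˡ _) (*-zeroʳ y))

  eval≡∑coeff : ∀ (p : Poly) D → (∀ m → D ℕ.< m → coeff p m ≡ + 0) → ∀ y → eval p y ≡ ∑[ m < ℕ.suc D ] (coeff p (toℕ m) * y ^ toℕ m)
  eval≡∑coeff []      D         high≡0 y = sym (trans (sum-cong-≗ {ℕ.suc D} (λ m → *-zeroˡ (y ^ toℕ m))) (sum-replicate-zero (ℕ.suc D)))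
  eval≡∑coeff (a ∷ p) ℕ.zero    high≡0 y = begin
    a + y * eval p y    ≡⟨ cong (λ z → a + y * z) (eval≡0 p (λ m → high≡0 (ℕ.suc m) ℕ.z<s) y) ⟩
    a + y * + 0         ≡⟨ trans (cong (_+_ a) (*-zeroʳ y)) (+-identityʳ a) ⟩
    a                   ≡⟨ trans (+-identityʳ _) (*-identityʳ a) ⟨
    a * + 1 + + 0       ∎
    where open ≡-Reasoning
  eval≡∑coeff (a ∷ p) (ℕ.suc D) high≡0 y = begin
    a + y * eval p y
      ≡⟨ cong (λ z → a + y * z) (eval≡∑coeff p D (λ m D<m → high≡0 (ℕ.suc m) (ℕ.s≤s D<m)) y) ⟩
    a + y * ∑[ m < ℕ.suc D ] (coeff p (toℕ m) * y ^ toℕ m)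
      ≡⟨ cong₂ _+_ (sym (*-identityʳ a)) (*-distribˡ-sum {ℕ.suc D} y (λ m → coeff p (toℕ m) * y ^ toℕ m)) ⟩
    a * + 1 + ∑[ m < ℕ.suc D ] (y * (coeff p (toℕ m) * y ^ toℕ m))
      ≡⟨ cong (_+_ (a * + 1)) (sum-cong-≗ {ℕ.suc D} (λ m → solve 3 (λ y c p → y :* (c :* p) := c :* (y :* p)) refl y (coeff p (toℕ m)) (y ^ toℕ m))) ⟩
    a * + 1 + ∑[ m < ℕ.suc D ] (coeff p (toℕ m) * y ^ ℕ.suc (toℕ m)) ∎
    where open ≡-Reasoning

  eval≡low+∑top : ∀ (p : Poly) n → (∀ m → 2 ℕ.+ n ℕ.< m → coeff p m ≡ + 0) → ∀ y →
    eval p y ≡ coeff p 0 + coeff p 1 * y + ∑[ t < ℕ.suc n ] (coeff p (2 ℕ.+ n ℕ.∸ toℕ t) * y ^ (2 ℕ.+ n ℕ.∸ toℕ t))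
  eval≡low+∑top p n high≡0 y = begin
    eval p y
      ≡⟨ eval≡∑coeff p (2 ℕ.+ n) high≡0 y ⟩
    coeff p 0 * + 1 + (coeff p 1 * (y * + 1) + ∑[ i < ℕ.suc n ] g (2 ℕ.+ toℕ i))
      ≡⟨ solve 4 (λ a b y s → a :* con (+ 1) :+ (b :* (y :* con (+ 1)) :+ s) := a :+ b :* y :+ s) refl (coeff p 0) (coeff p 1) y _ ⟩
    coeff p 0 + coeff p 1 * y + ∑[ i < ℕ.suc n ] g (2 ℕ.+ toℕ i)
      ≡⟨ cong (_+_ (coeff p 0 + coeff p 1 * y)) (trans (∑-permute (λ i → g (2 ℕ.+ toℕ i)) reverse) (sum-cong-≗ reversed)) ⟩
    coeff p 0 + coeff p 1 * y + ∑[ t < ℕ.suc n ] g (2 ℕ.+ n ℕ.∸ toℕ t) ∎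
    where
    open ≡-Reasoning
    g : ℕ → ℤ
    g m = coeff p m * y ^ m
    reversed : ∀ t → g (2 ℕ.+ toℕ (Fin.opposite t)) ≡ g (2 ℕ.+ n ℕ.∸ toℕ t)
    reversed t = trans (cong (λ m → g (2 ℕ.+ m)) (opposite-prop t)) (cong g (sym (ℕ.+-∸-assoc 2 (ℕ.≤-pred (toℕ<n t)))))

  falling : ℤ → ℕ → ℤ
  falling y ℕ.zero    = + 1
  falling y (ℕ.suc j) = y * falling (y - + 1) j

  fallingPoly : ℤ → ℕ → Poly
  fallingPoly a ℕ.zero    = + 1 ∷ []
  fallingPoly a (ℕ.suc j) = X+ a · fallingPoly (a - + 1) j

  risingPoly : ℕ → Poly
  risingPoly ℕ.zero    = + 1 ∷ []
  risingPoly (ℕ.suc k) = X+ (+ k) · risingPoly k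

  eval-one : ∀ y → eval (+ 1 ∷ []) y ≡ + 1
  eval-one y = trans (cong (_+_ (+ 1)) (*-zeroʳ y)) refl

  eval-fallingPoly : ∀ a j x → eval (fallingPoly a j) x ≡ falling (x + a) j
  eval-fallingPoly a ℕ.zero    x = eval-one x
  eval-fallingPoly a (ℕ.suc j) x = trans (eval-X+· a (fallingPoly (a - + 1) j) x)
    (cong ((x + a) *_) (trans (eval-fallingPoly (a - + 1) j x) (cong (λ z → falling z j) (sym (+-assoc x a (- + 1))))))

  coeff-fallingPoly-high : ∀ a j m → j ℕ.< m → coeff (fallingPoly a j) m ≡ + 0
  coeff-fallingPoly-high a ℕ.zero    (ℕ.suc m) _ = refl
  coeff-fallingPoly-high a (ℕ.suc j) (ℕ.suc m) (ℕ.s≤s j<m) = begin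
    coeff (X+ a · fallingPoly (a - + 1) j) (ℕ.suc m)                                    ≡⟨ coeff-X+·-suc a (fallingPoly (a - + 1) j) m ⟩
    a * coeff (fallingPoly (a - + 1) j) (ℕ.suc m) + coeff (fallingPoly (a - + 1) j) m  ≡⟨ cong₂ (λ u v → a * u + v)
        (coeff-fallingPoly-high (a - + 1) j (ℕ.suc m) (ℕ.m<n⇒m<1+n j<m)) (coeff-fallingPoly-high (a - + 1) j m j<m) ⟩
    a * + 0 + + 0                                                                       ≡⟨ trans (+-identityʳ _) (*-zeroʳ a) ⟩
    + 0                                                                                 ∎
    where open ≡-Reasoning

  coeff-fallingPoly-top : ∀ a j → coeff (fallingPoly a j) j ≡ + 1
  coeff-fallingPoly-top a ℕ.zero    = refl
  coeff-fallingPoly-top a (ℕ.suc j) = begin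
    coeff (X+ a · fallingPoly (a - + 1) j) (ℕ.suc j)                                    ≡⟨ coeff-X+·-suc a (fallingPoly (a - + 1) j) j ⟩
    a * coeff (fallingPoly (a - + 1) j) (ℕ.suc j) + coeff (fallingPoly (a - + 1) j) j  ≡⟨ cong₂ (λ u v → a * u + v)
        (coeff-fallingPoly-high (a - + 1) j (ℕ.suc j) (ℕ.n<1+n j)) (coeff-fallingPoly-top (a - + 1) j) ⟩
    a * + 0 + + 1                                                                       ≡⟨ cong (_+ + 1) (*-zeroʳ a) ⟩
    + 1                                                                                 ∎
    where open ≡-Reasoning

  coeff-risingPoly : ∀ k m → coeff (risingPoly k) m ≡ + stirling1 k m
  coeff-risingPoly ℕ.zero    ℕ.zero    = refl
  coeff-risingPoly ℕ.zero    (ℕ.suc m) = refl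
  coeff-risingPoly (ℕ.suc k) ℕ.zero    = begin
    coeff (X+ (+ k) · risingPoly k) 0    ≡⟨ coeff-X+·-zero (+ k) (risingPoly k) ⟩
    + k * coeff (risingPoly k) 0         ≡⟨ cong (+ k *_) (coeff-risingPoly k 0) ⟩
    + k * + stirling1 k 0                ≡⟨ pos-* k (stirling1 k 0) ⟨
    + stirling1 (ℕ.suc k) 0              ∎
    where open ≡-Reasoning
  coeff-risingPoly (ℕ.suc k) (ℕ.suc m) = begin
    coeff (X+ (+ k) · risingPoly k) (ℕ.suc m)                          ≡⟨ coeff-X+·-suc (+ k) (risingPoly k) m ⟩
    + k * coeff (risingPoly k) (ℕ.suc m) + coeff (risingPoly k) m      ≡⟨ cong₂ (λ u v → + k * u + v) (coeff-risingPoly k (ℕ.suc m)) (coeff-risingPoly k m) ⟩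
    + k * + stirling1 k (ℕ.suc m) + + stirling1 k m                    ≡⟨ cong (_+ + stirling1 k m) (pos-* k (stirling1 k (ℕ.suc m))) ⟨
    + (k ℕ.* stirling1 k (ℕ.suc m)) + + stirling1 k m                  ≡⟨ pos-+ (k ℕ.* stirling1 k (ℕ.suc m)) (stirling1 k m) ⟨
    + stirling1 (ℕ.suc k) (ℕ.suc m)                                    ∎
    where open ≡-Reasoning

  falling≡!*C : ∀ n j → falling (+ n) j ≡ + (j ! ℕ.* (n C j))
  falling≡!*C n         ℕ.zero    = refl
  falling≡!*C ℕ.zero    (ℕ.suc j) = cong +_ (sym (ℕ.*-zeroʳ (ℕ.suc j !)))
  falling≡!*C (ℕ.suc n) (ℕ.suc j) = begin
    + ℕ.suc n * falling (+ ℕ.suc n - + 1) j      ≡⟨ cong (λ z → + ℕ.suc n * falling z j) (trans (m-n≡m⊖n (ℕ.suc n) 1) (⊖-≥ (ℕ.s≤s ℕ.z≤n))) ⟩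
    + ℕ.suc n * falling (+ n) j                  ≡⟨ cong (+ ℕ.suc n *_) (falling≡!*C n j) ⟩
    + ℕ.suc n * + (j ! ℕ.* (n C j))              ≡⟨ pos-* (ℕ.suc n) _ ⟨
    + (ℕ.suc n ℕ.* (j ! ℕ.* (n C j)))            ≡⟨ cong +_ absorb ⟩
    + (ℕ.suc j ! ℕ.* (ℕ.suc n C ℕ.suc j))        ∎
    where
    open ≡-Reasoning
    absorb : ℕ.suc n ℕ.* (j ! ℕ.* (n C j)) ≡ ℕ.suc j ! ℕ.* (ℕ.suc n C ℕ.suc j)
    absorb = begin
      ℕ.suc n ℕ.* (j ! ℕ.* (n C j))                   ≡⟨ x∙yz≈y∙xz (ℕ.suc n) (j !) (n C j) ⟩
      j ! ℕ.* (ℕ.suc n ℕ.* (n C j))                   ≡⟨ cong (j ! ℕ.*_) (C-absorb n j) ⟨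
      j ! ℕ.* (ℕ.suc j ℕ.* (ℕ.suc n C ℕ.suc j))       ≡⟨ x∙yz≈y∙xz (j !) (ℕ.suc j) _ ⟩
      ℕ.suc j ℕ.* (j ! ℕ.* (ℕ.suc n C ℕ.suc j))       ≡⟨ ℕ.*-assoc (ℕ.suc j) (j !) _ ⟨
      ℕ.suc j ! ℕ.* (ℕ.suc n C ℕ.suc j)               ∎

  eval-risingPoly : ∀ k x → eval (risingPoly (ℕ.suc k)) (+ x) ≡ + (ℕ.suc k ! ℕ.* ((x ℕ.+ k) C ℕ.suc k))
  eval-risingPoly ℕ.zero x = begin
    eval (X+ + 0 · risingPoly 0) (+ x)      ≡⟨ eval-X+· (+ 0) (risingPoly 0) (+ x) ⟩
    (+ x + + 0) * eval (+ 1 ∷ []) (+ x)     ≡⟨ cong₂ _*_ (+-identityʳ (+ x)) (eval-one (+ x)) ⟩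
    + x * + 1                               ≡⟨ *-identityʳ (+ x) ⟩
    + x                                     ≡⟨ cong +_ (trans (ℕ.+-identityʳ _) (trans (nC1≡n (x ℕ.+ 0)) (ℕ.+-identityʳ x))) ⟨
    + (1 ℕ.* ((x ℕ.+ 0) C 1))               ∎
    where open ≡-Reasoning
  eval-risingPoly (ℕ.suc k) x = begin
    eval (X+ + ℕ.suc k · risingPoly (ℕ.suc k)) (+ x)              ≡⟨ eval-X+· (+ ℕ.suc k) (risingPoly (ℕ.suc k)) (+ x) ⟩
    (+ x + + ℕ.suc k) * eval (risingPoly (ℕ.suc k)) (+ x)         ≡⟨ cong₂ _*_ (pos-+ x (ℕ.suc k)) (sym (eval-risingPoly k x)) ⟨
    + (x ℕ.+ ℕ.suc k) * + (ℕ.suc k ! ℕ.* (M C ℕ.suc k))          ≡⟨ pos-* (x ℕ.+ ℕ.suc k) _ ⟨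
    + ((x ℕ.+ ℕ.suc k) ℕ.* (ℕ.suc k ! ℕ.* (M C ℕ.suc k)))        ≡⟨ cong +_ absorb ⟩
    + (ℕ.suc (ℕ.suc k) ! ℕ.* ((x ℕ.+ ℕ.suc k) C ℕ.suc (ℕ.suc k))) ∎
    where
    open ≡-Reasoning
    M = x ℕ.+ k
    absorb : (x ℕ.+ ℕ.suc k) ℕ.* (ℕ.suc k ! ℕ.* (M C ℕ.suc k)) ≡ ℕ.suc (ℕ.suc k) ! ℕ.* ((x ℕ.+ ℕ.suc k) C ℕ.suc (ℕ.suc k))
    absorb = begin
      (x ℕ.+ ℕ.suc k) ℕ.* (ℕ.suc k ! ℕ.* (M C ℕ.suc k))                   ≡⟨ cong (ℕ._* (ℕ.suc k ! ℕ.* (M C ℕ.suc k))) (ℕ.+-suc x k) ⟩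
      ℕ.suc M ℕ.* (ℕ.suc k ! ℕ.* (M C ℕ.suc k))                           ≡⟨ x∙yz≈y∙xz (ℕ.suc M) (ℕ.suc k !) (M C ℕ.suc k) ⟩
      ℕ.suc k ! ℕ.* (ℕ.suc M ℕ.* (M C ℕ.suc k))                           ≡⟨ cong (ℕ.suc k ! ℕ.*_) (C-absorb M (ℕ.suc k)) ⟨
      ℕ.suc k ! ℕ.* (ℕ.suc (ℕ.suc k) ℕ.* (ℕ.suc M C ℕ.suc (ℕ.suc k)))     ≡⟨ x∙yz≈y∙xz (ℕ.suc k !) (ℕ.suc (ℕ.suc k)) _ ⟩
      ℕ.suc (ℕ.suc k) ℕ.* (ℕ.suc k ! ℕ.* (ℕ.suc M C ℕ.suc (ℕ.suc k)))     ≡⟨ ℕ.*-assoc (ℕ.suc (ℕ.suc k)) (ℕ.suc k !) _ ⟨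
      ℕ.suc (ℕ.suc k) ! ℕ.* (ℕ.suc M C ℕ.suc (ℕ.suc k))                   ≡⟨ cong (λ z → ℕ.suc (ℕ.suc k) ! ℕ.* (z C ℕ.suc (ℕ.suc k))) (ℕ.+-suc x k) ⟨
      ℕ.suc (ℕ.suc k) ! ℕ.* ((x ℕ.+ ℕ.suc k) C ℕ.suc (ℕ.suc k))           ∎

  falling-+ : ∀ y a b → falling y (a ℕ.+ b) ≡ falling y a * falling (y - + a) b
  falling-+ y ℕ.zero    b = sym (trans (*-identityˡ _) (cong (λ z → falling z b) (+-identityʳ y)))
  falling-+ y (ℕ.suc a) b = begin
    y * falling (y - + 1) (a ℕ.+ b)                          ≡⟨ cong (y *_) (falling-+ (y - + 1) a b) ⟩
    y * (falling (y - + 1) a * falling ((y - + 1) - + a) b)  ≡⟨ cong (λ z → y * (falling (y - + 1) a * falling z b)) y-1-a≡y-[1+a] ⟩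
    y * (falling (y - + 1) a * falling (y - + ℕ.suc a) b)    ≡⟨ *-assoc y _ _ ⟨
    y * falling (y - + 1) a * falling (y - + ℕ.suc a) b      ∎
    where
    open ≡-Reasoning
    y-1-a≡y-[1+a] : (y - + 1) - + a ≡ y - + ℕ.suc a
    y-1-a≡y-[1+a] = trans (solve 3 (λ y o a → (y :- o) :- a := y :- (o :+ a)) refl y (+ 1) (+ a)) (cong (_-_ y) (sym (pos-+ 1 a)))

  falling*! : ∀ k i → i ℕ.≤ k → falling (+ k) i * + ((k ℕ.∸ i) !) ≡ + (k !)
  falling*! k i i≤k = begin
    falling (+ k) i * + ((k ℕ.∸ i) !)                    ≡⟨ cong (falling (+ k) i *_) [k-i]!≡falling ⟩
    falling (+ k) i * falling (+ (k ℕ.∸ i)) (k ℕ.∸ i)    ≡⟨ cong (λ z → falling (+ k) i * falling z (k ℕ.∸ i)) (trans (m-n≡m⊖n k i) (⊖-≥ i≤k)) ⟨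
    falling (+ k) i * falling (+ k - + i) (k ℕ.∸ i)      ≡⟨ falling-+ (+ k) i (k ℕ.∸ i) ⟨
    falling (+ k) (i ℕ.+ (k ℕ.∸ i))                      ≡⟨ cong (falling (+ k)) (ℕ.m+[n∸m]≡n i≤k) ⟩
    falling (+ k) k                                      ≡⟨ falling≡n! k ⟩
    + (k !)                                              ∎
    where
    open ≡-Reasoning
    falling≡n! : ∀ n → falling (+ n) n ≡ + (n !)
    falling≡n! n = trans (falling≡!*C n n) (cong +_ (trans (cong (n ! ℕ.*_) (nCn≡1 n)) (ℕ.*-identityʳ _)))
    [k-i]!≡falling : + ((k ℕ.∸ i) !) ≡ falling (+ (k ℕ.∸ i)) (k ℕ.∸ i)
    [k-i]!≡falling = sym (falling≡n! (k ℕ.∸ i))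

  eval-at-0 : ∀ p → eval p (+ 0) ≡ coeff p 0
  eval-at-0 []      = refl
  eval-at-0 (a ∷ p) = +-identityʳ a

  stirling1-high : ∀ j m → j ℕ.< m → stirling1 j m ≡ 0
  stirling1-high ℕ.zero    (ℕ.suc m) _ = refl
  stirling1-high (ℕ.suc j) (ℕ.suc m) (ℕ.s≤s j<m) = begin
    j ℕ.* stirling1 j (ℕ.suc m) ℕ.+ stirling1 j m ≡⟨ cong₂ (λ a b → j ℕ.* a ℕ.+ b) (stirling1-high j (ℕ.suc m) (ℕ.m<n⇒m<1+n j<m)) (stirling1-high j m j<m) ⟩
    j ℕ.* 0 ℕ.+ 0                                 ≡⟨ trans (ℕ.+-identityʳ _) (ℕ.*-zeroʳ j) ⟩
    0                                             ∎
    where open ≡-Reasoning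

  stirling1-suc-zero : ∀ j → stirling1 (ℕ.suc j) 0 ≡ 0
  stirling1-suc-zero ℕ.zero    = refl
  stirling1-suc-zero (ℕ.suc j) = trans (cong (ℕ.suc j ℕ.*_) (stirling1-suc-zero j)) (ℕ.*-zeroʳ (ℕ.suc j))

-- Determinants

module _ where
  open import Data.Empty using (⊥-elim)
  open import Data.Fin as Fin using (Fin; zero; suc; toℕ; punchIn; punchOut; inject₁; fromℕ<)
  open import Data.Fin.Properties using (punchInᵢ≢i; punchIn-injective; punchIn-punchOut; toℕ-injective; toℕ-inject₁; toℕ-fromℕ<; toℕ<n)
  open import Data.Integer using (ℤ; +_; _+_; _*_; -_; _-_; _^_; ≢-nonZero)
  open import Data.Integer.Properties
  open import Data.Integer.Solver using (module +-*-Solver)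
  open import Data.Nat as ℕ using (ℕ; _!; NonZero)
  import Data.Nat.Properties as ℕ
  open import Data.Nat.Combinatorics using (_C_; nCn≡1; k>n⇒nCk≡0)
  open import Data.Product using (Σ; _×_; _,_; proj₁; proj₂)
  open import Data.Sum using (_⊎_; inj₁; inj₂)
  open import Data.Vec.Functional using (Vector; _∷_; updateAt; insertAt)
  open import Data.Vec.Functional.Properties using (updateAt-updates; updateAt-minimal; insertAt-lookup; insertAt-punchIn)
  open import Relation.Binary using (tri<; tri≈; tri>)
  open import Relation.Nullary using (¬_; Dec; yes; no)
  open import Relation.Nullary.Decidable using (dec-true; dec-false; isYes≗does)
  open import Algebra.Properties.CommutativeMonoid.Sum *-1-commutativeMonoid using () renaming (sum to prod; sum-cong-≗ to prod-cong-≗; sum-replicate-zero to prod-replicate-one; sum-remove to prod-remove)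
  open import Algebra.Properties.CommutativeSemigroup ℕ.*-commutativeSemigroup using (x∙yz≈y∙xz)
  open import Algebra.Properties.Semiring.Sum +-*-semiring using (sum; sum-syntax; sum-cong-≗; sum-replicate-zero; sum-remove; ∑-distrib-+; *-distribˡ-sum; *-distribʳ-sum)
  open +-*-Solver using (solve; _:+_; _:*_; _:-_; :-_; _:=_; con)

  Matrix : ℕ → Set
  Matrix n = Fin n → Fin n → ℤ

  sumFin≡sum : ∀ n (f : Fin n → ℤ) → sumFin n f ≡ sum f
  sumFin≡sum ℕ.zero    f = refl
  sumFin≡sum (ℕ.suc n) f = cong (_+_ (f zero)) (sumFin≡sum n (f ∘ suc))

  sum-zero : ∀ {n} {f : Fin n → ℤ} → (∀ i → f i ≡ + 0) → sum f ≡ + 0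
  sum-zero {n} f≗0 = trans (sum-cong-≗ f≗0) (sum-replicate-zero n)

  sum-single : ∀ {n} (f : Fin (ℕ.suc n) → ℤ) a → (∀ i → i ≢ a → f i ≡ + 0) → sum f ≡ f a
  sum-single f a f≗0 = begin
    sum f                                ≡⟨ sum-remove {i = a} f ⟩
    f a + sum (λ i → f (punchIn a i))    ≡⟨ cong (_+_ (f a)) (sum-zero (λ i → f≗0 (punchIn a i) (punchInᵢ≢i a i))) ⟩
    f a + + 0                            ≡⟨ +-identityʳ (f a) ⟩
    f a                                  ∎
    where open ≡-Reasoning

  sum-neg : ∀ {n} (f : Fin n → ℤ) → sum (λ i → - f i) ≡ - sum f
  sum-neg {ℕ.zero}  f = refl
  sum-neg {ℕ.suc n} f = trans (cong (_+_ (- f zero)) (sum-neg (f ∘ suc))) (sym (neg-distrib-+ (f zero) _))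

  δ : ∀ {n} → Fin n → Fin n → ℤ
  δ i j = if ⌊ i Fin.≟ j ⌋ then + 1 else + 0

  δ-refl : ∀ {n} (i : Fin n) → δ i i ≡ + 1
  δ-refl i rewrite isYes≗does (i Fin.≟ i) | dec-true (i Fin.≟ i) refl = refl

  δ-≢ : ∀ {n} {i j : Fin n} → i ≢ j → δ i j ≡ + 0
  δ-≢ {i = i} {j} i≢j rewrite isYes≗does (i Fin.≟ j) | dec-false (i Fin.≟ j) i≢j = refl

  δ-sym : ∀ {n} (i j : Fin n) → δ i j ≡ δ j i
  δ-sym i j = by-cases (i Fin.≟ j)
    where
    by-cases : Dec (i ≡ j) → δ i j ≡ δ j i
    by-cases (yes refl) = refl
    by-cases (no i≢j)   = trans (δ-≢ i≢j) (sym (δ-≢ (i≢j ∘ sym)))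

  δ-punchIn : ∀ {n} (a : Fin (ℕ.suc n)) (i j : Fin n) → δ (punchIn a i) (punchIn a j) ≡ δ i j
  δ-punchIn a i j = by-cases (i Fin.≟ j)
    where
    by-cases : Dec (i ≡ j) → δ (punchIn a i) (punchIn a j) ≡ δ i j
    by-cases (yes refl) = trans (δ-refl _) (sym (δ-refl i))
    by-cases (no i≢j)   = trans (δ-≢ (i≢j ∘ punchIn-injective a i j)) (sym (δ-≢ i≢j))

  sum-δ : ∀ {n} (a : Fin n) (f : Fin n → ℤ) → ∑[ j < n ] (δ a j * f j) ≡ f a
  sum-δ {ℕ.suc n} a f = begin
    ∑[ j < ℕ.suc n ] (δ a j * f j)  ≡⟨ sum-single _ a (λ j j≢a → trans (cong (_* f j) (δ-≢ (j≢a ∘ sym))) (*-zeroˡ (f j))) ⟩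
    δ a a * f a                    ≡⟨ cong (_* f a) (δ-refl a) ⟩
    + 1 * f a                      ≡⟨ *-identityˡ (f a) ⟩
    f a                            ∎
    where open ≡-Reasoning

  sum-*δ : ∀ {n} (a : Fin n) (f : Fin n → ℤ) → ∑[ j < n ] (f j * δ j a) ≡ f a
  sum-*δ a f = trans (sum-cong-≗ (λ j → trans (*-comm (f j) _) (cong (_* f j) (δ-sym j a)))) (sum-δ a f)

  minor : ∀ {n} → Fin (ℕ.suc n) → Matrix (ℕ.suc n) → Matrix n
  minor j M r c = M (suc r) (punchIn j c)

  det-expand : ∀ n (M : Matrix (ℕ.suc n)) → det (ℕ.suc n) M ≡ ∑[ j < ℕ.suc n ] (sign (toℕ j) * M zero j * det n (minor j M))
  det-expand n M = sumFin≡sum (ℕ.suc n) (λ j → sign (toℕ j) * M zero j * det n (minor j M))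

  det-cong : ∀ n {M M′ : Matrix n} → (∀ i j → M i j ≡ M′ i j) → det n M ≡ det n M′
  det-cong ℕ.zero    M≗M′ = refl
  det-cong (ℕ.suc n) {M} {M′} M≗M′ = trans (det-expand n M) (trans (sum-cong-≗ terms≡) (sym (det-expand n M′)))
    where
    terms≡ : ∀ j → sign (toℕ j) * M zero j * det n (minor j M) ≡ sign (toℕ j) * M′ zero j * det n (minor j M′)
    terms≡ j = cong₂ (λ a b → sign (toℕ j) * a * b) (M≗M′ zero j) (det-cong n (λ r c → M≗M′ (suc r) (punchIn j c)))

  det-single-entry : ∀ n (M : Matrix (ℕ.suc n)) a → (∀ j → j ≢ a → M zero j ≡ + 0) →
    det (ℕ.suc n) M ≡ sign (toℕ a) * M zero a * det n (minor a M)
  det-single-entry n M a row≗0 = trans (det-expand n M) (sum-single _ a (λ j j≢a →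
    trans (cong (λ z → sign (toℕ j) * z * det n (minor j M)) (row≗0 j j≢a))
          (trans (cong (_* det n (minor j M)) (*-zeroʳ (sign (toℕ j)))) (*-zeroˡ (det n (minor j M))))))

  det-identity : ∀ n → det n δ ≡ + 1
  det-identity ℕ.zero    = refl
  det-identity (ℕ.suc n) = begin
    det (ℕ.suc n) δ                            ≡⟨ det-single-entry n δ zero (λ j j≢0 → δ-≢ (j≢0 ∘ sym)) ⟩
    + 1 * δ {ℕ.suc n} zero zero * det n (minor zero δ) ≡⟨ cong (λ z → + 1 * z * det n (minor zero δ)) (δ-refl {ℕ.suc n} zero) ⟩
    + 1 * + 1 * det n (minor zero δ)           ≡⟨ *-identityˡ (det n (minor zero δ)) ⟩
    det n (minor zero δ)                       ≡⟨ det-cong n (δ-punchIn zero) ⟩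
    det n δ                                    ≡⟨ det-identity n ⟩
    + 1                                        ∎
    where open ≡-Reasoning

  det-linear-column : ∀ n (M U W : Matrix n) c a →
    (∀ i l → l ≢ c → M i l ≡ U i l × M i l ≡ W i l) →
    (∀ i → M i c ≡ a * U i c + W i c) →
    det n M ≡ a * det n U + det n W
  det-linear-column (ℕ.suc n) M U W c a off on = begin
    det (ℕ.suc n) M                   ≡⟨ det-expand n M ⟩
    sum term[ M ]                     ≡⟨ sum-cong-≗ (λ j → expand-term j (j Fin.≟ c)) ⟩
    ∑[ j < ℕ.suc n ] (a * term[ U ] j + term[ W ] j)   ≡⟨ ∑-distrib-+ (λ j → a * term[ U ] j) term[ W ] ⟩
    sum (λ j → a * term[ U ] j) + sum term[ W ]       ≡⟨ cong (_+ sum term[ W ]) (*-distribˡ-sum a term[ U ]) ⟨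
    a * sum term[ U ] + sum term[ W ]                 ≡⟨ cong₂ (λ u w → a * u + w) (det-expand n U) (det-expand n W) ⟨
    a * det (ℕ.suc n) U + det (ℕ.suc n) W             ∎
    where
    open ≡-Reasoning
    term[_] : Matrix (ℕ.suc n) → Fin (ℕ.suc n) → ℤ
    term[ X ] j = sign (toℕ j) * X zero j * det n (minor j X)
    expand-term : ∀ j → Dec (j ≡ c) → term[ M ] j ≡ a * term[ U ] j + term[ W ] j
    expand-term j (yes refl) = begin
      sign (toℕ j) * M zero j * det n (minor j M)
        ≡⟨ cong₂ (λ u v → sign (toℕ j) * u * v) (on zero) minorM≡minorU ⟩
      sign (toℕ j) * (a * U zero j + W zero j) * det n (minor j U)
        ≡⟨ solve 5 (λ s u w d a → s :* (a :* u :+ w) :* d := a :* (s :* u :* d) :+ s :* w :* d) refl (sign (toℕ j)) (U zero j) (W zero j) (det n (minor j U)) a ⟩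
      a * term[ U ] j + sign (toℕ j) * W zero j * det n (minor j U)
        ≡⟨ cong (λ v → a * term[ U ] j + sign (toℕ j) * W zero j * v) (trans (sym minorM≡minorU) minorM≡minorW) ⟩
      a * term[ U ] j + term[ W ] j ∎
      where
      minorM≡minorU : det n (minor j M) ≡ det n (minor j U)
      minorM≡minorU = det-cong n (λ r x → proj₁ (off (suc r) (punchIn j x) (punchInᵢ≢i j x)))
      minorM≡minorW : det n (minor j M) ≡ det n (minor j W)
      minorM≡minorW = det-cong n (λ r x → proj₂ (off (suc r) (punchIn j x) (punchInᵢ≢i j x)))
    expand-term j (no j≢c) = begin
      sign (toℕ j) * M zero j * det n (minor j M)
        ≡⟨ cong₂ (λ u v → sign (toℕ j) * u * v) (proj₁ (off zero j j≢c)) minor-linear ⟩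
      sign (toℕ j) * U zero j * (a * det n (minor j U) + det n (minor j W))
        ≡⟨ solve 5 (λ s u d e a → s :* u :* (a :* d :+ e) := a :* (s :* u :* d) :+ s :* u :* e) refl (sign (toℕ j)) (U zero j) (det n (minor j U)) (det n (minor j W)) a ⟩
      a * term[ U ] j + sign (toℕ j) * U zero j * det n (minor j W)
        ≡⟨ cong (λ u → a * term[ U ] j + sign (toℕ j) * u * det n (minor j W)) (trans (sym (proj₁ (off zero j j≢c))) (proj₂ (off zero j j≢c))) ⟩
      a * term[ U ] j + term[ W ] j ∎
      where
      c′ = punchOut j≢c
      punchIn-c′ : punchIn j c′ ≡ c
      punchIn-c′ = punchIn-punchOut j≢c
      minor-linear : det n (minor j M) ≡ a * det n (minor j U) + det n (minor j W)
      minor-linear = det-linear-column n (minor j M) (minor j U) (minor j W) c′ a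
        (λ r x x≢c′ → off (suc r) (punchIn j x) (λ eq → x≢c′ (punchIn-injective j x c′ (trans eq (sym punchIn-c′)))))
        (λ r → subst (λ z → M (suc r) z ≡ a * U (suc r) z + W (suc r) z) (sym punchIn-c′) (on (suc r)))

  punchIn-adjacent : ∀ {n} (c x : Fin (ℕ.suc n)) →
    punchIn (inject₁ c) x ≡ punchIn (suc c) x ⊎ (punchIn (inject₁ c) x ≡ suc c × punchIn (suc c) x ≡ inject₁ c)
  punchIn-adjacent zero    zero    = inj₂ (refl , refl)
  punchIn-adjacent zero    (suc x) = inj₁ refl
  punchIn-adjacent (suc c) zero    = inj₁ refl
  punchIn-adjacent {ℕ.suc n} (suc c) (suc x) with punchIn-adjacent c x
  ... | inj₁ eq          = inj₁ (cong suc eq)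
  ... | inj₂ (eq₁ , eq₂) = inj₂ (cong suc eq₁ , cong suc eq₂)

  punchIn-inject₁-self : ∀ {n} (c : Fin (ℕ.suc n)) → punchIn (inject₁ c) c ≡ suc c
  punchIn-inject₁-self zero                = refl
  punchIn-inject₁-self {ℕ.suc n} (suc c) = cong suc (punchIn-inject₁-self c)

  adjacent-in-minor : ∀ {m} (j : Fin (ℕ.suc (ℕ.suc m))) (c : Fin (ℕ.suc m)) → j ≢ inject₁ c → j ≢ suc c →
    Σ (Fin m) (λ c′ → punchIn j (inject₁ c′) ≡ inject₁ c × punchIn j (suc c′) ≡ suc c)
  adjacent-in-minor {ℕ.zero}  zero             zero    j≢c j≢c+1 = ⊥-elim (j≢c refl)
  adjacent-in-minor {ℕ.zero}  (suc zero)       zero    j≢c j≢c+1 = ⊥-elim (j≢c+1 refl)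
  adjacent-in-minor {ℕ.suc m} zero             zero    j≢c j≢c+1 = ⊥-elim (j≢c refl)
  adjacent-in-minor {ℕ.suc m} zero             (suc c) j≢c j≢c+1 = c , refl , refl
  adjacent-in-minor {ℕ.suc m} (suc zero)       zero    j≢c j≢c+1 = ⊥-elim (j≢c+1 refl)
  adjacent-in-minor {ℕ.suc m} (suc (suc j))    zero    j≢c j≢c+1 = zero , refl , refl
  adjacent-in-minor {ℕ.suc m} (suc j)          (suc c) j≢c j≢c+1
    with adjacent-in-minor {m} j c (j≢c ∘ cong suc) (j≢c+1 ∘ cong suc)
  ... | c′ , eq₁ , eq₂ = suc c′ , cong suc eq₁ , cong suc eq₂

  det-inject₁-suc-columns : ∀ n (M : Matrix (ℕ.suc (ℕ.suc n))) c → (∀ i → M i (inject₁ c) ≡ M i (suc c)) → det (ℕ.suc (ℕ.suc n)) M ≡ + 0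
  det-inject₁-suc-columns n M c cols≡ = begin
    det (ℕ.suc (ℕ.suc n)) M
      ≡⟨ trans (det-expand (ℕ.suc n) M) (sum-remove {i = inject₁ c} term) ⟩
    term (inject₁ c) + sum (λ x → term (punchIn (inject₁ c) x))
      ≡⟨ cong (_+_ (term (inject₁ c))) (sum-remove {i = c} (λ x → term (punchIn (inject₁ c) x))) ⟩
    term (inject₁ c) + (term (punchIn (inject₁ c) c) + sum (λ y → term (punchIn (inject₁ c) (punchIn c y))))
      ≡⟨ cong₂ (λ u v → term (inject₁ c) + (u + v)) (cong term (punchIn-inject₁-self c)) (others-vanish n refl) ⟩
    term (inject₁ c) + (term (suc c) + + 0)
      ≡⟨ cong (_+_ (term (inject₁ c))) (+-identityʳ (term (suc c))) ⟩
    term (inject₁ c) + term (suc c)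
      ≡⟨ pair-cancels ⟩
    + 0 ∎
    where
    open ≡-Reasoning
    term : Fin (ℕ.suc (ℕ.suc n)) → ℤ
    term j = sign (toℕ j) * M zero j * det (ℕ.suc n) (minor j M)
    D = det (ℕ.suc n) (minor (suc c) M)
    minors≡ : ∀ r x → minor (inject₁ c) M r x ≡ minor (suc c) M r x
    minors≡ r x with punchIn-adjacent c x
    ... | inj₁ eq          = cong (M (suc r)) eq
    ... | inj₂ (eq₁ , eq₂) = trans (cong (M (suc r)) eq₁) (trans (sym (cols≡ (suc r))) (cong (M (suc r)) (sym eq₂)))
    pair-cancels : term (inject₁ c) + term (suc c) ≡ + 0
    pair-cancels = begin
      sign (toℕ (inject₁ c)) * M zero (inject₁ c) * det (ℕ.suc n) (minor (inject₁ c) M) + (- sign (toℕ c)) * M zero (suc c) * D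
        ≡⟨ cong₂ (λ u v → sign u * M zero (inject₁ c) * v + (- sign (toℕ c)) * M zero (suc c) * D) (toℕ-inject₁ c) (det-cong (ℕ.suc n) minors≡) ⟩
      sign (toℕ c) * M zero (inject₁ c) * D + (- sign (toℕ c)) * M zero (suc c) * D
        ≡⟨ cong (λ u → sign (toℕ c) * u * D + (- sign (toℕ c)) * M zero (suc c) * D) (cols≡ zero) ⟩
      sign (toℕ c) * M zero (suc c) * D + (- sign (toℕ c)) * M zero (suc c) * D
        ≡⟨ solve 3 (λ s m d → s :* m :* d :+ (:- s) :* m :* d := con (+ 0)) refl (sign (toℕ c)) (M zero (suc c)) D ⟩
      + 0 ∎
    others-vanish : ∀ m → m ≡ n → sum (λ y → term (punchIn (inject₁ c) (punchIn c y))) ≡ + 0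
    others-vanish ℕ.zero    refl = refl
    others-vanish (ℕ.suc m) refl = sum-zero vanish
      where
      vanish : ∀ y → term (punchIn (inject₁ c) (punchIn c y)) ≡ + 0
      vanish y with adjacent-in-minor (punchIn (inject₁ c) (punchIn c y)) c (punchInᵢ≢i (inject₁ c) (punchIn c y))
                  (λ eq → punchInᵢ≢i c y (punchIn-injective (inject₁ c) (punchIn c y) c (trans eq (sym (punchIn-inject₁-self c)))))
      ... | c′ , eq₁ , eq₂ = trans (cong (sign (toℕ j) * M zero j *_)
                                     (det-inject₁-suc-columns m (minor j M) c′ (λ r → trans (cong (M (suc r)) eq₁) (trans (cols≡ (suc r)) (cong (M (suc r)) (sym eq₂))))))
                                   (*-zeroʳ (sign (toℕ j) * M zero j))
        where j = punchIn (inject₁ c) (punchIn c y)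

  det-adjacent-columns : ∀ n (M : Matrix n) r s → toℕ s ≡ ℕ.suc (toℕ r) → (∀ i → M i r ≡ M i s) → det n M ≡ + 0
  det-adjacent-columns (ℕ.suc ℕ.zero)     M r zero    () cols≡
  det-adjacent-columns (ℕ.suc (ℕ.suc m))  M r zero    () cols≡
  det-adjacent-columns (ℕ.suc (ℕ.suc m))  M r (suc c) s≡r+1 cols≡ =
    det-inject₁-suc-columns m M c (λ i → trans (cong (M i) (sym r≡c)) (cols≡ i))
    where
    r≡c : r ≡ inject₁ c
    r≡c = toℕ-injective (trans (sym (ℕ.suc-injective s≡r+1)) (sym (toℕ-inject₁ c)))

  setRows : ∀ {n} → Matrix n → Fin n → Fin n → Vector ℤ n → Vector ℤ n → Matrix n
  setRows M r s x y = updateAt (updateAt M r (λ _ → x)) s (λ _ → y)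

  module _ {n} (M : Matrix n) {r s : Fin n} where

    setRows-r : r ≢ s → ∀ x y → setRows M r s x y r ≡ x
    setRows-r r≢s x y = trans (updateAt-minimal r s _ r≢s) (updateAt-updates r M)

    setRows-s : ∀ x y → setRows M r s x y s ≡ y
    setRows-s x y = updateAt-updates s _

    setRows-other : ∀ x y {i} → i ≢ r → i ≢ s → setRows M r s x y i ≡ M i
    setRows-other x y {i} i≢r i≢s = trans (updateAt-minimal i s _ i≢s) (updateAt-minimal i r M i≢r)

    setRows-≢r : ∀ x x′ y {i} → i ≢ r → setRows M r s x y i ≡ setRows M r s x′ y i
    setRows-≢r x x′ y {i} i≢r with i Fin.≟ s
    ... | yes refl = trans (setRows-s x y) (sym (setRows-s x′ y))
    ... | no i≢s   = trans (setRows-other x y i≢r i≢s) (sym (setRows-other x′ y i≢r i≢s))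

    setRows-≢s : ∀ x y y′ {i} → i ≢ s → setRows M r s x y i ≡ setRows M r s x y′ i
    setRows-≢s x y y′ {i} i≢s = trans (updateAt-minimal i s _ i≢s) (sym (updateAt-minimal i s _ i≢s))

    setRows-≗ : ∀ (M′ : Matrix n) {x y} → r ≢ s → (∀ j → M′ r j ≡ x j) → (∀ j → M′ s j ≡ y j) →
      (∀ i → i ≢ r → i ≢ s → ∀ j → M′ i j ≡ M i j) → ∀ i j → setRows M r s x y i j ≡ M′ i j
    setRows-≗ M′ {x} {y} r≢s M′r≡x M′s≡y M′≡M i j with i Fin.≟ r | i Fin.≟ s
    ... | yes refl | _        = trans (cong-app (setRows-r r≢s x y) j) (sym (M′r≡x j))
    ... | no _     | yes refl = trans (cong-app (setRows-s x y) j) (sym (M′s≡y j))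
    ... | no i≢r   | no i≢s   = trans (cong-app (setRows-other x y i≢r i≢s) j) (sym (M′≡M i i≢r i≢s j))

  hybrid : ∀ {A : Set} {n} → ℕ → Vector A n → Vector A n → Vector A n
  hybrid p new old r with toℕ r ℕ.<? p
  ... | yes _ = new r
  ... | no _  = old r

  hybrid-< : ∀ {A : Set} {n p} (new old : Vector A n) {r} → toℕ r ℕ.< p → hybrid p new old r ≡ new r
  hybrid-< {p = p} new old {r} r<p with toℕ r ℕ.<? p
  ... | yes _  = refl
  ... | no r≮p = ⊥-elim (r≮p r<p)

  hybrid-≮ : ∀ {A : Set} {n p} (new old : Vector A n) {r} → ¬ (toℕ r ℕ.< p) → hybrid p new old r ≡ old r
  hybrid-≮ {p = p} new old {r} r≮p with toℕ r ℕ.<? p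
  ... | yes r<p = ⊥-elim (r≮p r<p)
  ... | no _    = refl

  record IsAlternatingMultilinear {n} (F : Matrix n → ℤ) : Set where
    field
      F-cong         : ∀ {M M′} → (∀ i j → M i j ≡ M′ i j) → F M ≡ F M′
      linear         : ∀ (M U W : Matrix n) r a →
                       (∀ i → i ≢ r → ∀ j → M i j ≡ U i j × M i j ≡ W i j) →
                       (∀ j → M r j ≡ a * U r j + W r j) → F M ≡ a * F U + F W
      adjacent-equal : ∀ M r s → toℕ s ≡ ℕ.suc (toℕ r) → (∀ j → M r j ≡ M s j) → F M ≡ + 0

  module IsAlternatingMultilinearProperties {n} {F : Matrix n → ℤ} (isAM : IsAlternatingMultilinear F) where
    open IsAlternatingMultilinear isAM

    additive : ∀ (M U W : Matrix n) r → (∀ i → i ≢ r → ∀ j → M i j ≡ U i j × M i j ≡ W i j) →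
      (∀ j → M r j ≡ U r j + W r j) → F M ≡ F U + F W
    additive M U W r off on = trans (linear M U W r (+ 1) off (λ j → trans (on j) (cong (_+ W r j) (sym (*-identityˡ (U r j))))))
                                    (cong (_+ F W) (*-identityˡ (F U)))

    zero-row : ∀ M r → (∀ j → M r j ≡ + 0) → F M ≡ + 0
    zero-row M r row≗0 = x≡x+x⇒x≡0 (additive M M M r (λ _ _ _ → refl , refl)
      (λ j → trans (row≗0 j) (sym (cong (λ z → z + z) (row≗0 j)))))
      where
      x≡x+x⇒x≡0 : ∀ {x} → x ≡ x + x → x ≡ + 0
      x≡x+x⇒x≡0 {x} eq = begin
        x                 ≡⟨ solve 1 (λ x → x := (x :+ x) :+ (:- x)) refl x ⟩
        (x + x) + (- x)   ≡⟨ cong (_+ (- x)) eq ⟨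
        x + (- x)         ≡⟨ +-inverseʳ x ⟩
        + 0               ∎
        where open ≡-Reasoning

    -- The standard trick: expand F with both rows equal to u + v.
    swap-adjacent : ∀ (M M′ : Matrix n) r s → toℕ s ≡ ℕ.suc (toℕ r) →
      (∀ j → M′ r j ≡ M s j) → (∀ j → M′ s j ≡ M r j) → (∀ i → i ≢ r → i ≢ s → ∀ j → M′ i j ≡ M i j) →
      F M′ ≡ - F M
    swap-adjacent M M′ r s s≡r+1 M′r≡Ms M′s≡Mr M′≡M = begin
      F M′                    ≡⟨ solve 2 (λ a b → b := (a :+ b) :+ (:- a)) refl (F M) (F M′) ⟩
      (F M + F M′) + - F M    ≡⟨ cong (_+ - F M) sum≡0 ⟩
      + 0 + - F M             ≡⟨ +-identityˡ (- F M) ⟩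
      - F M                   ∎
      where
      open ≡-Reasoning
      r≢s : r ≢ s
      r≢s r≡s = ℕ.1+n≢n (sym (trans (cong toℕ r≡s) s≡r+1))
      X : Vector ℤ n → Vector ℤ n → Matrix n
      X = setRows M r s
      X-equal : ∀ x → F (X x x) ≡ + 0
      X-equal x = adjacent-equal (X x x) r s s≡r+1 (cong-app (trans (setRows-r M r≢s x x) (sym (setRows-s M x x))))
      u+v : Vector ℤ n
      u+v j = M r j + M s j
      additive-r : ∀ y → F (X u+v y) ≡ F (X (M r) y) + F (X (M s) y)
      additive-r y = additive _ _ _ r
        (λ i i≢r j → cong-app (setRows-≢r M u+v (M r) y i≢r) j , cong-app (setRows-≢r M u+v (M s) y i≢r) j)
        (λ j → trans (cong-app (setRows-r M r≢s u+v y) j)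
                     (sym (cong₂ _+_ (cong-app (setRows-r M r≢s (M r) y) j) (cong-app (setRows-r M r≢s (M s) y) j))))
      additive-s : ∀ x → F (X x u+v) ≡ F (X x (M r)) + F (X x (M s))
      additive-s x = additive _ _ _ s
        (λ i i≢s j → cong-app (setRows-≢s M x u+v (M r) i≢s) j , cong-app (setRows-≢s M x u+v (M s) i≢s) j)
        (λ j → trans (cong-app (setRows-s M x u+v) j)
                     (sym (cong₂ _+_ (cong-app (setRows-s M x (M r)) j) (cong-app (setRows-s M x (M s)) j))))
      sum≡0 : F M + F M′ ≡ + 0
      sum≡0 = begin
        F M + F M′
          ≡⟨ cong₂ _+_ (F-cong (setRows-≗ M M r≢s (λ _ → refl) (λ _ → refl) (λ _ _ _ _ → refl)))
                       (F-cong (setRows-≗ M M′ r≢s M′r≡Ms M′s≡Mr M′≡M)) ⟨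
        F (X (M r) (M s)) + F (X (M s) (M r))
          ≡⟨ solve 2 (λ a b → a :+ b := (con (+ 0) :+ a) :+ (b :+ con (+ 0))) refl (F (X (M r) (M s))) (F (X (M s) (M r))) ⟩
        (+ 0 + F (X (M r) (M s))) + (F (X (M s) (M r)) + + 0)
          ≡⟨ cong₂ (λ a b → (a + F (X (M r) (M s))) + (F (X (M s) (M r)) + b)) (X-equal (M r)) (X-equal (M s)) ⟨
        (F (X (M r) (M r)) + F (X (M r) (M s))) + (F (X (M s) (M r)) + F (X (M s) (M s)))
          ≡⟨ cong₂ _+_ (additive-s (M r)) (additive-s (M s)) ⟨
        F (X (M r) u+v) + F (X (M s) u+v)
          ≡⟨ additive-r u+v ⟨
        F (X u+v u+v)
          ≡⟨ X-equal u+v ⟩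
        + 0 ∎

    equal-rows-apart : ∀ d M r s → toℕ s ≡ d ℕ.+ ℕ.suc (toℕ r) → (∀ j → M r j ≡ M s j) → F M ≡ + 0
    equal-rows-apart ℕ.zero    M r s       s≡1+r     rows≡ = adjacent-equal M r s s≡1+r rows≡
    equal-rows-apart (ℕ.suc d) M r (suc c) s≡2+d+r rows≡ = begin
      F M      ≡⟨ neg-involutive (F M) ⟨
      - - F M  ≡⟨ cong -_ F[M′]≡-F[M] ⟨
      - F M′   ≡⟨ cong -_ (equal-rows-apart d M′ r s′ s′≡1+d+r M′r≡M′s′) ⟩
      + 0      ∎
      where
      open ≡-Reasoning
      s′ = inject₁ c
      s′≡1+d+r : toℕ s′ ≡ d ℕ.+ ℕ.suc (toℕ r)
      s′≡1+d+r = trans (toℕ-inject₁ c) (ℕ.suc-injective s≡2+d+r)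
      s≡1+s′ : toℕ (suc c) ≡ ℕ.suc (toℕ s′)
      s≡1+s′ = cong ℕ.suc (sym (toℕ-inject₁ c))
      s′≢s : s′ ≢ suc c
      s′≢s eq = ℕ.1+n≢n (sym (trans (cong toℕ eq) s≡1+s′))
      r≢s′ : r ≢ s′
      r≢s′ eq = ℕ.<⇒≢ (ℕ.m≤n+m (ℕ.suc (toℕ r)) d) (trans (cong toℕ eq) s′≡1+d+r)
      r≢s : r ≢ suc c
      r≢s eq = ℕ.<⇒≢ (ℕ.m≤n+m (ℕ.suc (toℕ r)) (ℕ.suc d)) (trans (cong toℕ eq) s≡2+d+r)
      M′ : Matrix n
      M′ = setRows M s′ (suc c) (M (suc c)) (M s′)
      F[M′]≡-F[M] : F M′ ≡ - F M
      F[M′]≡-F[M] = swap-adjacent M M′ s′ (suc c) s≡1+s′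
        (cong-app (setRows-r M s′≢s (M (suc c)) (M s′)))
        (cong-app (setRows-s M {s′} {suc c} (M (suc c)) (M s′)))
        (λ i i≢s′ i≢s → cong-app (setRows-other M (M (suc c)) (M s′) i≢s′ i≢s))
      M′r≡M′s′ : ∀ j → M′ r j ≡ M′ s′ j
      M′r≡M′s′ j = begin
        M′ r j          ≡⟨ cong-app (setRows-other M (M (suc c)) (M s′) r≢s′ r≢s) j ⟩
        M r j           ≡⟨ rows≡ j ⟩
        M (suc c) j     ≡⟨ cong-app (setRows-r M s′≢s (M (suc c)) (M s′)) j ⟨
        M′ s′ j         ∎

    equal-rows : ∀ M r s → r ≢ s → (∀ j → M r j ≡ M s j) → F M ≡ + 0
    equal-rows M r s r≢s rows≡ with ℕ.<-cmp (toℕ r) (toℕ s)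
    ... | tri< r<s _ _ = equal-rows-apart (toℕ s ℕ.∸ ℕ.suc (toℕ r)) M r s (sym (ℕ.m∸n+n≡m r<s)) rows≡
    ... | tri≈ _ r≡s _ = ⊥-elim (r≢s (toℕ-injective r≡s))
    ... | tri> _ _ s<r = equal-rows-apart (toℕ r ℕ.∸ ℕ.suc (toℕ s)) M s r (sym (ℕ.m∸n+n≡m s<r)) (λ j → sym (rows≡ j))

  ≡⊎punchIn : ∀ {n} (j l : Fin (ℕ.suc n)) → j ≡ l ⊎ Σ (Fin n) (λ c → punchIn j c ≡ l)
  ≡⊎punchIn j l with j Fin.≟ l
  ... | yes j≡l = inj₁ j≡l
  ... | no j≢l  = inj₂ (punchOut j≢l , punchIn-punchOut j≢l)

  insertAt-cong : ∀ {n} (j : Fin (ℕ.suc n)) {b b′ : Vector ℤ n} → (∀ c → b c ≡ b′ c) → ∀ l → insertAt b j (+ 0) l ≡ insertAt b′ j (+ 0) l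
  insertAt-cong j {b} {b′} b≗b′ l with ≡⊎punchIn j l
  ... | inj₁ refl       = trans (insertAt-lookup b j (+ 0)) (sym (insertAt-lookup b′ j (+ 0)))
  ... | inj₂ (c , refl) = trans (insertAt-punchIn b j (+ 0) c) (trans (b≗b′ c) (sym (insertAt-punchIn b′ j (+ 0) c)))

  insertAt-linear : ∀ {n} (j : Fin (ℕ.suc n)) a {b u w : Vector ℤ n} → (∀ c → b c ≡ a * u c + w c) →
    ∀ l → insertAt b j (+ 0) l ≡ a * insertAt u j (+ 0) l + insertAt w j (+ 0) l
  insertAt-linear j a {b} {u} {w} b≗au+w l with ≡⊎punchIn j l
  ... | inj₁ refl = begin
    insertAt b j (+ 0) j                                   ≡⟨ insertAt-lookup b j (+ 0) ⟩
    + 0                                                    ≡⟨ trans (cong (_+ + 0) (*-zeroʳ a)) (+-identityʳ (+ 0)) ⟨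
    a * + 0 + + 0                                          ≡⟨ cong₂ (λ x y → a * x + y) (insertAt-lookup u j (+ 0)) (insertAt-lookup w j (+ 0)) ⟨
    a * insertAt u j (+ 0) j + insertAt w j (+ 0) j        ∎
    where open ≡-Reasoning
  ... | inj₂ (c , refl) = begin
    insertAt b j (+ 0) (punchIn j c)                       ≡⟨ insertAt-punchIn b j (+ 0) c ⟩
    b c                                                    ≡⟨ b≗au+w c ⟩
    a * u c + w c                                          ≡⟨ cong₂ (λ x y → a * x + y) (insertAt-punchIn u j (+ 0) c) (insertAt-punchIn w j (+ 0) c) ⟨
    a * insertAt u j (+ 0) (punchIn j c) + insertAt w j (+ 0) (punchIn j c) ∎
    where open ≡-Reasoning

  insertAt-δ : ∀ {n} (j : Fin (ℕ.suc n)) (r : Fin n) l → insertAt (δ r) j (+ 0) l ≡ δ (punchIn j r) l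
  insertAt-δ j r l with ≡⊎punchIn j l
  ... | inj₁ refl       = trans (insertAt-lookup (δ r) j (+ 0)) (sym (δ-≢ (punchInᵢ≢i j r)))
  ... | inj₂ (c , refl) = trans (insertAt-punchIn (δ r) j (+ 0) c) (sym (δ-punchIn j r c))

  row-split : ∀ {n} (j : Fin (ℕ.suc n)) (R : Vector ℤ (ℕ.suc n)) l → R l ≡ R j * δ j l + insertAt (R ∘ punchIn j) j (+ 0) l
  row-split j R l with ≡⊎punchIn j l
  ... | inj₁ refl = sym (begin
    R j * δ j j + insertAt (R ∘ punchIn j) j (+ 0) j    ≡⟨ cong₂ (λ x y → R j * x + y) (δ-refl j) (insertAt-lookup (R ∘ punchIn j) j (+ 0)) ⟩
    R j * + 1 + + 0                                   ≡⟨ trans (+-identityʳ _) (*-identityʳ (R j)) ⟩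
    R j                                               ∎)
    where open ≡-Reasoning
  ... | inj₂ (c , refl) = sym (begin
    R j * δ j (punchIn j c) + insertAt (R ∘ punchIn j) j (+ 0) (punchIn j c)
      ≡⟨ cong₂ (λ x y → R j * x + y) (δ-≢ (punchInᵢ≢i j c ∘ sym)) (insertAt-punchIn (R ∘ punchIn j) j (+ 0) c) ⟩
    R j * + 0 + R (punchIn j c)     ≡⟨ trans (cong (_+ R (punchIn j c)) (*-zeroʳ (R j))) (+-identityˡ _) ⟩
    R (punchIn j c)                 ∎)
    where open ≡-Reasoning

  insertColumn : ∀ {n} → Fin (ℕ.suc n) → Matrix n → Matrix (ℕ.suc n)
  insertColumn j B = δ j ∷ (λ r → insertAt (B r) j (+ 0))

  det-insertColumn-δ : ∀ n (j : Fin (ℕ.suc n)) → det (ℕ.suc n) (insertColumn j δ) ≡ sign (toℕ j)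
  det-insertColumn-δ n j = begin
    det (ℕ.suc n) (insertColumn j δ)                      ≡⟨ det-single-entry n (insertColumn j δ) j (λ l l≢j → δ-≢ (l≢j ∘ sym)) ⟩
    sign (toℕ j) * δ j j * det n (minor j (insertColumn j δ)) ≡⟨ cong₂ (λ a b → sign (toℕ j) * a * b) (δ-refl j) minor≡δ ⟩
    sign (toℕ j) * + 1 * + 1                             ≡⟨ trans (*-identityʳ _) (*-identityʳ _) ⟩
    sign (toℕ j)                                         ∎
    where
    open ≡-Reasoning
    minor≡δ : det n (minor j (insertColumn j δ)) ≡ + 1
    minor≡δ = trans (det-cong n (λ r c → insertAt-punchIn (δ r) j (+ 0) c)) (det-identity n)

  module _ {n} {F : Matrix (ℕ.suc n) → ℤ} (isAM : IsAlternatingMultilinear F) where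
    open IsAlternatingMultilinear isAM
    open IsAlternatingMultilinearProperties isAM

    linear-first-row : ∀ m (a : Fin m → ℤ) (v : Fin m → Vector ℤ (ℕ.suc n)) (R : Fin n → Vector ℤ (ℕ.suc n)) →
      F ((λ l → ∑[ k < m ] (a k * v k l)) ∷ R) ≡ ∑[ k < m ] (a k * F (v k ∷ R))
    linear-first-row ℕ.zero    a v R = zero-row _ zero (λ _ → refl)
    linear-first-row (ℕ.suc m) a v R = begin
      F ((λ l → ∑[ k < ℕ.suc m ] (a k * v k l)) ∷ R)
        ≡⟨ linear _ (v zero ∷ R) ((λ l → ∑[ k < m ] (a (suc k) * v (suc k) l)) ∷ R) zero (a zero) other-rows (λ _ → refl) ⟩
      a zero * F (v zero ∷ R) + F ((λ l → ∑[ k < m ] (a (suc k) * v (suc k) l)) ∷ R)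
        ≡⟨ cong (_+_ (a zero * F (v zero ∷ R))) (linear-first-row m (a ∘ suc) (v ∘ suc) R) ⟩
      ∑[ k < ℕ.suc m ] (a k * F (v k ∷ R)) ∎
      where
      open ≡-Reasoning
      other-rows : ∀ i → i ≢ zero → ∀ l → _ × _
      other-rows zero    i≢0 l = ⊥-elim (i≢0 refl)
      other-rows (suc i) i≢0 l = refl , refl

    expand-first-row : ∀ (M : Matrix (ℕ.suc n)) → F M ≡ ∑[ j < ℕ.suc n ] (M zero j * F (δ j ∷ (M ∘ suc)))
    expand-first-row M = trans (F-cong M≡) (linear-first-row (ℕ.suc n) (M zero) δ (M ∘ suc))
      where
      M≡ : ∀ i l → M i l ≡ ((λ l → ∑[ j < ℕ.suc n ] (M zero j * δ j l)) ∷ (M ∘ suc)) i l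
      M≡ zero    l = sym (sum-*δ l (M zero))
      M≡ (suc i) l = refl

    add-multiple-of-first-row : ∀ (w : Vector ℤ (ℕ.suc n)) (R R′ : Fin n → Vector ℤ (ℕ.suc n)) r a →
      (∀ l → R r l ≡ a * w l + R′ r l) → (∀ i → i ≢ r → ∀ l → R i l ≡ R′ i l) → F (w ∷ R) ≡ F (w ∷ R′)
    add-multiple-of-first-row w R R′ r a row-r other-rows = begin
      F (w ∷ R)                ≡⟨ linear (w ∷ R) U (w ∷ R′) (suc r) a off on ⟩
      a * F U + F (w ∷ R′)     ≡⟨ cong (λ z → a * z + F (w ∷ R′)) U≡0 ⟩
      a * + 0 + F (w ∷ R′)     ≡⟨ trans (cong (_+ F (w ∷ R′)) (*-zeroʳ a)) (+-identityˡ _) ⟩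
      F (w ∷ R′)               ∎
      where
      open ≡-Reasoning
      U : Matrix (ℕ.suc n)
      U = w ∷ updateAt R r (λ _ → w)
      U≡0 : F U ≡ + 0
      U≡0 = equal-rows U zero (suc r) (λ ()) (λ l → sym (cong-app (updateAt-updates r R) l))
      off : ∀ i → i ≢ suc r → ∀ l → (w ∷ R) i l ≡ U i l × (w ∷ R) i l ≡ (w ∷ R′) i l
      off zero    _      l = refl , refl
      off (suc i) i≢1+r l = sym (cong-app (updateAt-minimal i r R (i≢1+r ∘ cong suc)) l) , other-rows i (i≢1+r ∘ cong suc) l
      on : ∀ l → R r l ≡ a * U (suc r) l + R′ r l
      on l = trans (row-r l) (cong (λ z → a * z + R′ r l) (sym (cong-app (updateAt-updates r R) l)))

    clear-column : ∀ j (R R′ : Fin n → Vector ℤ (ℕ.suc n)) → (∀ r l → R r l ≡ R r j * δ j l + R′ r l) →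
      F (δ j ∷ R) ≡ F (δ j ∷ R′)
    clear-column j R R′ R≡ = trans (sym (cleared n ℕ.≤-refl)) (F-cong all-cleared)
      where
      H : ℕ → Fin n → Vector ℤ (ℕ.suc n)
      H p = hybrid p R′ R
      all-cleared : ∀ i l → (δ j ∷ H n) i l ≡ (δ j ∷ R′) i l
      all-cleared zero    l = refl
      all-cleared (suc i) l = cong-app (hybrid-< R′ R (toℕ<n i)) l
      none-cleared : ∀ i l → (δ j ∷ H 0) i l ≡ (δ j ∷ R) i l
      none-cleared zero    l = refl
      none-cleared (suc i) l = cong-app (hybrid-≮ {p = 0} R′ R (λ ())) l
      cleared : ∀ p → p ℕ.≤ n → F (δ j ∷ H p) ≡ F (δ j ∷ R)
      cleared ℕ.zero    _   = F-cong none-cleared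
      cleared (ℕ.suc p) p<n = trans (sym clear-row-p) (cleared p (ℕ.<⇒≤ p<n))
        where
        rₚ : Fin n
        rₚ = fromℕ< p<n
        rₚ≡p : toℕ rₚ ≡ p
        rₚ≡p = toℕ-fromℕ< p<n
        row-rₚ : ∀ l → H p rₚ l ≡ R rₚ j * δ j l + H (ℕ.suc p) rₚ l
        row-rₚ l = begin
          H p rₚ l                   ≡⟨ cong-app (hybrid-≮ R′ R (λ rₚ<p → ℕ.<-irrefl rₚ≡p rₚ<p)) l ⟩
          R rₚ l                     ≡⟨ R≡ rₚ l ⟩
          R rₚ j * δ j l + R′ rₚ l   ≡⟨ cong (λ row → R rₚ j * δ j l + row l) (hybrid-< R′ R (ℕ.s≤s (ℕ.≤-reflexive rₚ≡p))) ⟨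
          R rₚ j * δ j l + H (ℕ.suc p) rₚ l ∎
          where open ≡-Reasoning
        other-rows : ∀ i → i ≢ rₚ → ∀ l → H p i l ≡ H (ℕ.suc p) i l
        other-rows i i≢rₚ l = cong-app (by-cases (toℕ i ℕ.<? p)) l
          where
          by-cases : Dec (toℕ i ℕ.< p) → H p i ≡ H (ℕ.suc p) i
          by-cases (yes i<p) = trans (hybrid-< R′ R i<p) (sym (hybrid-< R′ R (ℕ.m<n⇒m<1+n i<p)))
          by-cases (no i≮p)  = trans (hybrid-≮ R′ R i≮p) (sym (hybrid-≮ R′ R (λ i<1+p →
            i≮p (ℕ.≤∧≢⇒< (ℕ.≤-pred i<1+p) (λ i≡p → i≢rₚ (toℕ-injective (trans i≡p (sym rₚ≡p))))))))
        clear-row-p : F (δ j ∷ H p) ≡ F (δ j ∷ H (ℕ.suc p))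
        clear-row-p = add-multiple-of-first-row (δ j) (H p) (H (ℕ.suc p)) rₚ (R rₚ j) row-rₚ other-rows

    insertColumn-isAM : ∀ j → IsAlternatingMultilinear (λ B → F (insertColumn j B))
    insertColumn-isAM j = record
      { F-cong         = λ B≗B′ → F-cong (rows≡ B≗B′)
      ; linear         = λ B U W r a off on → linear (insertColumn j B) (insertColumn j U) (insertColumn j W) (suc r) a
                                                (other-rows off) (insertAt-linear j a on)
      ; adjacent-equal = λ B r s s≡1+r rows≡ → adjacent-equal (insertColumn j B) (suc r) (suc s) (cong ℕ.suc s≡1+r) (insertAt-cong j rows≡)
      }
      where
      rows≡ : ∀ {B B′ : Matrix n} → (∀ i k → B i k ≡ B′ i k) → ∀ i l → insertColumn j B i l ≡ insertColumn j B′ i l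
      rows≡ B≗B′ zero    l = refl
      rows≡ B≗B′ (suc i) l = insertAt-cong j (B≗B′ i) l
      other-rows : ∀ {B U W : Matrix n} {r} → (∀ i → i ≢ r → ∀ k → B i k ≡ U i k × B i k ≡ W i k) →
        ∀ i → i ≢ suc r → ∀ l → insertColumn j B i l ≡ insertColumn j U i l × insertColumn j B i l ≡ insertColumn j W i l
      other-rows off zero    i≢r l = refl , refl
      other-rows off (suc i) i≢r l = insertAt-cong j (λ c → proj₁ (off i (i≢r ∘ cong suc) c)) l ,
                                     insertAt-cong j (λ c → proj₂ (off i (i≢r ∘ cong suc) c)) l

  insertColumn-zero-δ : ∀ {n} i l → insertColumn {n} zero δ i l ≡ δ i l
  insertColumn-zero-δ zero    l = refl
  insertColumn-zero-δ (suc r) l = insertAt-δ zero r l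

  F-insertColumn-δ : ∀ n {F : Matrix (ℕ.suc n) → ℤ} → IsAlternatingMultilinear F →
    (∀ (G : Matrix n → ℤ) → IsAlternatingMultilinear G → ∀ B → G B ≡ det n B * G δ) →
    ∀ j → F (insertColumn j δ) ≡ sign (toℕ j) * F δ
  F-insertColumn-δ n isAM unique zero = trans (F-cong insertColumn-zero-δ) (sym (*-identityˡ _))
    where open IsAlternatingMultilinear isAM
  F-insertColumn-δ (ℕ.suc n) {F} isAM unique (suc j) = begin
    F (insertColumn (suc j) δ)                                   ≡⟨ neg-involutive _ ⟨
    - - F (insertColumn (suc j) δ)                               ≡⟨ cong -_ swapped ⟨
    - F M′                                                       ≡⟨ cong -_ (unique _ (insertColumn-isAM isAM zero) (insertColumn j δ)) ⟩
    - (det (ℕ.suc n) (insertColumn j δ) * F (insertColumn zero δ)) ≡⟨ cong₂ (λ a b → - (a * b)) (det-insertColumn-δ n j) (F-cong insertColumn-zero-δ) ⟩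
    - (sign (toℕ j) * F δ)                                       ≡⟨ neg-distribˡ-* (sign (toℕ j)) (F δ) ⟩
    sign (toℕ (suc j)) * F δ                                     ∎
    where
    open ≡-Reasoning
    open IsAlternatingMultilinear isAM
    open IsAlternatingMultilinearProperties isAM
    M′ : Matrix (ℕ.suc (ℕ.suc n))
    M′ = insertColumn zero (insertColumn j δ)
    others : ∀ i → i ≢ zero → i ≢ suc zero → ∀ l → M′ i l ≡ insertColumn (suc j) δ i l
    others zero          i≢0 _   l = ⊥-elim (i≢0 refl)
    others (suc zero)    _   i≢1 l = ⊥-elim (i≢1 refl)
    others (suc (suc r)) _   _   l = trans (insertAt-cong zero (insertAt-δ j r) l) (trans (insertAt-δ zero (punchIn j r) l) (sym (insertAt-δ (suc j) (suc r) l)))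
    swapped : F M′ ≡ - F (insertColumn (suc j) δ)
    swapped = swap-adjacent (insertColumn (suc j) δ) M′ zero (suc zero) refl
      (λ l → sym (insertAt-δ (suc j) zero l)) (λ l → insertAt-δ zero j l) others

  det-unique : ∀ n (F : Matrix n → ℤ) → IsAlternatingMultilinear F → ∀ M → F M ≡ det n M * F δ
  det-unique ℕ.zero    F isAM M = trans (IsAlternatingMultilinear.F-cong isAM (λ ())) (sym (*-identityˡ _))
  det-unique (ℕ.suc n) F isAM M = begin
    F M                                                                    ≡⟨ expand-first-row isAM M ⟩
    ∑[ j < ℕ.suc n ] (M zero j * F (δ j ∷ (M ∘ suc)))                       ≡⟨ sum-cong-≗ (λ j → cong (M zero j *_) (F-row j)) ⟩
    ∑[ j < ℕ.suc n ] (M zero j * (det n (minor j M) * (sign (toℕ j) * F δ))) ≡⟨ sum-cong-≗ (λ j → reorder (M zero j) (det n (minor j M)) (sign (toℕ j))) ⟩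
    ∑[ j < ℕ.suc n ] (sign (toℕ j) * M zero j * det n (minor j M) * F δ)     ≡⟨ *-distribʳ-sum (F δ) (λ j → sign (toℕ j) * M zero j * det n (minor j M)) ⟨
    ∑[ j < ℕ.suc n ] (sign (toℕ j) * M zero j * det n (minor j M)) * F δ     ≡⟨ cong (_* F δ) (det-expand n M) ⟨
    det (ℕ.suc n) M * F δ                                                  ∎
    where
    open ≡-Reasoning
    open IsAlternatingMultilinear isAM
    reorder : ∀ m d s → m * (d * (s * F δ)) ≡ s * m * d * F δ
    reorder m d s = solve 4 (λ m d s f → m :* (d :* (s :* f)) := s :* m :* d :* f) refl m d s (F δ)
    F-row : ∀ j → F (δ j ∷ (M ∘ suc)) ≡ det n (minor j M) * (sign (toℕ j) * F δ)
    F-row j = begin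
      F (δ j ∷ (M ∘ suc))                         ≡⟨ clear-column isAM j (M ∘ suc) (λ r → insertAt (minor j M r) j (+ 0)) (λ r → row-split j (M (suc r))) ⟩
      F (insertColumn j (minor j M))              ≡⟨ det-unique n _ (insertColumn-isAM isAM j) (minor j M) ⟩
      det n (minor j M) * F (insertColumn j δ)    ≡⟨ cong (det n (minor j M) *_) (F-insertColumn-δ n isAM (det-unique n) j) ⟩
      det n (minor j M) * (sign (toℕ j) * F δ)    ∎

  transpose : ∀ {n} → Matrix n → Matrix n
  transpose M i j = M j i

  det∘transpose-isAM : ∀ n → IsAlternatingMultilinear (λ (X : Matrix n) → det n (transpose X))
  det∘transpose-isAM n = record
    { F-cong         = λ X≗X′ → det-cong n (λ i j → X≗X′ j i)
    ; linear         = λ M U W r a off on → det-linear-column n (transpose M) (transpose U) (transpose W) r a (λ i l l≢r → off l l≢r i) on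
    ; adjacent-equal = λ M r s s≡1+r rows≡ → det-adjacent-columns n (transpose M) r s s≡1+r rows≡
    }

  det-transpose : ∀ n (X : Matrix n) → det n (transpose X) ≡ det n X
  det-transpose n X = begin
    det n (transpose X)                ≡⟨ det-unique n _ (det∘transpose-isAM n) X ⟩
    det n X * det n (transpose δ)      ≡⟨ cong (det n X *_) (trans (det-cong n (λ i j → δ-sym j i)) (det-identity n)) ⟩
    det n X * + 1                      ≡⟨ *-identityʳ _ ⟩
    det n X                            ∎
    where open ≡-Reasoning

  infixl 7 _∙_
  _∙_ : ∀ {n} → Matrix n → Matrix n → Matrix n
  (A ∙ B) i j = ∑[ l < _ ] (A i l * B l j)

  det[A∙Xᵀ]-isAM : ∀ n (A : Matrix n) → IsAlternatingMultilinear (λ (X : Matrix n) → det n (A ∙ transpose X))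
  det[A∙Xᵀ]-isAM n A = record
    { F-cong         = λ X≗X′ → det-cong n (λ i j → sum-cong-≗ (λ l → cong (A i l *_) (X≗X′ j l)))
    ; linear         = λ M U W r a off on → det-linear-column n (A ∙ transpose M) (A ∙ transpose U) (A ∙ transpose W) r a
                         (λ i l l≢r → sum-cong-≗ (λ k → cong (A i k *_) (proj₁ (off l l≢r k))) ,
                                      sum-cong-≗ (λ k → cong (A i k *_) (proj₂ (off l l≢r k))))
                         (λ i → linear-row M U W r a on i)
    ; adjacent-equal = λ M r s s≡1+r rows≡ → det-adjacent-columns n (A ∙ transpose M) r s s≡1+r
                         (λ i → sum-cong-≗ (λ k → cong (A i k *_) (rows≡ k)))
    }
    where
    linear-row : ∀ (M U W : Matrix n) r a → (∀ j → M r j ≡ a * U r j + W r j) → ∀ i →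
      ∑[ k < n ] (A i k * M r k) ≡ a * ∑[ k < n ] (A i k * U r k) + ∑[ k < n ] (A i k * W r k)
    linear-row M U W r a on i = begin
      ∑[ k < n ] (A i k * M r k)                          ≡⟨ sum-cong-≗ (λ k → trans (cong (A i k *_) (on k))
                                                             (solve 4 (λ x a u w → x :* (a :* u :+ w) := a :* (x :* u) :+ x :* w) refl (A i k) a (U r k) (W r k))) ⟩
      ∑[ k < n ] (a * (A i k * U r k) + A i k * W r k)    ≡⟨ ∑-distrib-+ (λ k → a * (A i k * U r k)) (λ k → A i k * W r k) ⟩
      ∑[ k < n ] (a * (A i k * U r k)) + ∑[ k < n ] (A i k * W r k) ≡⟨ cong (_+ ∑[ k < n ] (A i k * W r k)) (*-distribˡ-sum a (λ k → A i k * U r k)) ⟨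
      a * ∑[ k < n ] (A i k * U r k) + ∑[ k < n ] (A i k * W r k) ∎
      where open ≡-Reasoning

  det-∙ : ∀ n (A B : Matrix n) → det n (A ∙ B) ≡ det n A * det n B
  det-∙ n A B = begin
    det n (A ∙ B)                                          ≡⟨ det-unique n _ (det[A∙Xᵀ]-isAM n A) (transpose B) ⟩
    det n (transpose B) * det n (A ∙ transpose δ)          ≡⟨ cong₂ _*_ (det-transpose n B) (det-cong n A∙δ≡A) ⟩
    det n B * det n A                                      ≡⟨ *-comm (det n B) (det n A) ⟩
    det n A * det n B                                      ∎
    where
    open ≡-Reasoning
    A∙δ≡A : ∀ i j → (A ∙ transpose δ) i j ≡ A i j
    A∙δ≡A i j = trans (sum-cong-≗ (λ l → cong (A i l *_) (δ-sym j l))) (sum-*δ j (A i))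

  det-lower-triangular : ∀ n (L : Matrix n) → (∀ i j → toℕ i ℕ.< toℕ j → L i j ≡ + 0) → det n L ≡ prod (λ i → L i i)
  det-lower-triangular ℕ.zero    L upper≡0 = refl
  det-lower-triangular (ℕ.suc n) L upper≡0 = begin
    det (ℕ.suc n) L                                   ≡⟨ det-single-entry n L zero (λ j j≢0 → upper≡0 zero j (0<toℕ j j≢0)) ⟩
    + 1 * L zero zero * det n (minor zero L)          ≡⟨ cong₂ _*_ (*-identityˡ (L zero zero)) (det-lower-triangular n (minor zero L) (λ i j i<j → upper≡0 (suc i) (suc j) (ℕ.s≤s i<j))) ⟩
    L zero zero * prod (λ i → L (suc i) (suc i))      ∎
    where
    open ≡-Reasoning
    0<toℕ : ∀ (j : Fin (ℕ.suc n)) → j ≢ zero → 0 ℕ.< toℕ j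
    0<toℕ zero    j≢0 = ⊥-elim (j≢0 refl)
    0<toℕ (suc j) _   = ℕ.z<s

  det-upper-triangular : ∀ n (U : Matrix n) → (∀ i j → toℕ j ℕ.< toℕ i → U i j ≡ + 0) → det n U ≡ prod (λ i → U i i)
  det-upper-triangular n U lower≡0 = trans (sym (det-transpose n U)) (det-lower-triangular n (transpose U) (λ i j i<j → lower≡0 j i i<j))

  det-scale : ∀ n c (M : Matrix n) → det n (λ i j → c * M i j) ≡ c ^ n * det n M
  det-scale ℕ.zero    c M = refl
  det-scale (ℕ.suc n) c M = begin
    det (ℕ.suc n) (λ i j → c * M i j)
      ≡⟨ det-expand n (λ i j → c * M i j) ⟩
    ∑[ j < ℕ.suc n ] (sign (toℕ j) * (c * M zero j) * det n (λ r x → c * minor j M r x))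
      ≡⟨ sum-cong-≗ (λ j → cong (λ z → sign (toℕ j) * (c * M zero j) * z) (det-scale n c (minor j M))) ⟩
    ∑[ j < ℕ.suc n ] (sign (toℕ j) * (c * M zero j) * (c ^ n * det n (minor j M)))
      ≡⟨ sum-cong-≗ (λ j → solve 5 (λ s c m p d → s :* (c :* m) :* (p :* d) := (c :* p) :* (s :* m :* d)) refl (sign (toℕ j)) c (M zero j) (c ^ n) (det n (minor j M))) ⟩
    ∑[ j < ℕ.suc n ] (c ^ ℕ.suc n * (sign (toℕ j) * M zero j * det n (minor j M)))
      ≡⟨ *-distribˡ-sum (c ^ ℕ.suc n) (λ j → sign (toℕ j) * M zero j * det n (minor j M)) ⟨
    c ^ ℕ.suc n * ∑[ j < ℕ.suc n ] (sign (toℕ j) * M zero j * det n (minor j M))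
      ≡⟨ cong (c ^ ℕ.suc n *_) (det-expand n M) ⟨
    c ^ ℕ.suc n * det (ℕ.suc n) M ∎
    where open ≡-Reasoning

  det-linear-first-row : ∀ n (p q : Vector ℤ (ℕ.suc n)) (R : Fin n → Vector ℤ (ℕ.suc n)) a b →
    det (ℕ.suc n) ((λ l → a * p l + b * q l) ∷ R) ≡ a * det (ℕ.suc n) (p ∷ R) + b * det (ℕ.suc n) (q ∷ R)
  det-linear-first-row n p q R a b = begin
    det (ℕ.suc n) ((λ l → a * p l + b * q l) ∷ R)
      ≡⟨ det-expand n ((λ l → a * p l + b * q l) ∷ R) ⟩
    ∑[ j < ℕ.suc n ] (sign (toℕ j) * (a * p j + b * q j) * D j)
      ≡⟨ sum-cong-≗ (λ j → solve 6 (λ s a p b q d → s :* (a :* p :+ b :* q) :* d := a :* (s :* p :* d) :+ b :* (s :* q :* d)) refl (sign (toℕ j)) a (p j) b (q j) (D j)) ⟩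
    ∑[ j < ℕ.suc n ] (a * (sign (toℕ j) * p j * D j) + b * (sign (toℕ j) * q j * D j))
      ≡⟨ ∑-distrib-+ (λ j → a * (sign (toℕ j) * p j * D j)) (λ j → b * (sign (toℕ j) * q j * D j)) ⟩
    ∑[ j < ℕ.suc n ] (a * (sign (toℕ j) * p j * D j)) + ∑[ j < ℕ.suc n ] (b * (sign (toℕ j) * q j * D j))
      ≡⟨ cong₂ _+_ (*-distribˡ-sum a (λ j → sign (toℕ j) * p j * D j)) (*-distribˡ-sum b (λ j → sign (toℕ j) * q j * D j)) ⟨
    a * ∑[ j < ℕ.suc n ] (sign (toℕ j) * p j * D j) + b * ∑[ j < ℕ.suc n ] (sign (toℕ j) * q j * D j)
      ≡⟨ cong₂ (λ x y → a * x + b * y) (det-expand n (p ∷ R)) (det-expand n (q ∷ R)) ⟨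
    a * det (ℕ.suc n) (p ∷ R) + b * det (ℕ.suc n) (q ∷ R) ∎
    where
    open ≡-Reasoning
    D : Fin (ℕ.suc n) → ℤ
    D j = det n (λ r c → R r (punchIn j c))

  -- Subtracting u (1 + r) times the first row v from row 1 + r leaves d (1 + r) on the diagonal.
  det[v∷d+u⊗v] : ∀ n (d u v : Fin (ℕ.suc n) → ℤ) →
    det (ℕ.suc n) (v ∷ (λ r l → δ (suc r) l * d (suc r) + u (suc r) * v l)) ≡ v zero * prod (d ∘ suc)
  det[v∷d+u⊗v] n d u v = trans (det-cong _ E∙X≡v∷R) (trans (det-∙ _ E X) (trans (cong₂ _*_ det-E det-X) (*-identityˡ _)))
    where
    open ≡-Reasoning
    R : Fin n → Vector ℤ (ℕ.suc n)
    R r l = δ (suc r) l * d (suc r) + u (suc r) * v l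
    E X : Matrix (ℕ.suc n)
    E = δ zero ∷ (λ r k → δ (suc r) k + δ zero k * u (suc r))
    X = v ∷ (λ r l → δ (suc r) l * d (suc r))
    E∙X≡v∷R : ∀ i l → (v ∷ R) i l ≡ (E ∙ X) i l
    E∙X≡v∷R zero    l = sym (sum-δ zero (λ k → X k l))
    E∙X≡v∷R (suc r) l = sym (begin
      ∑[ k < ℕ.suc n ] ((δ (suc r) k + δ zero k * u (suc r)) * X k l)
        ≡⟨ sum-cong-≗ (λ k → solve 4 (λ a b c x → (a :+ b :* c) :* x := a :* x :+ b :* (c :* x)) refl (δ (suc r) k) (δ zero k) (u (suc r)) (X k l)) ⟩
      ∑[ k < ℕ.suc n ] (δ (suc r) k * X k l + δ zero k * (u (suc r) * X k l))
        ≡⟨ ∑-distrib-+ (λ k → δ (suc r) k * X k l) (λ k → δ zero k * (u (suc r) * X k l)) ⟩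
      ∑[ k < ℕ.suc n ] (δ (suc r) k * X k l) + ∑[ k < ℕ.suc n ] (δ zero k * (u (suc r) * X k l))
        ≡⟨ cong₂ _+_ (sum-δ (suc r) (λ k → X k l)) (sum-δ zero (λ k → u (suc r) * X k l)) ⟩
      δ (suc r) l * d (suc r) + u (suc r) * v l ∎)
    det-E : det (ℕ.suc n) E ≡ + 1
    det-E = trans (det-lower-triangular _ E upper≡0) (trans (prod-cong-≗ diagonal≡1) (prod-replicate-one (ℕ.suc n)))
      where
      upper≡0 : ∀ i j → toℕ i ℕ.< toℕ j → E i j ≡ + 0
      upper≡0 zero    j       i<j = δ-≢ (λ eq → ℕ.<-irrefl (cong toℕ eq) i<j)
      upper≡0 (suc r) zero    ()
      upper≡0 (suc r) (suc k) i<j = trans (cong₂ _+_ (δ-≢ (λ eq → ℕ.<-irrefl (cong toℕ eq) i<j)) (*-zeroˡ (u (suc r)))) refl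
      diagonal≡1 : ∀ i → E i i ≡ + 1
      diagonal≡1 zero    = δ-refl {ℕ.suc n} zero
      diagonal≡1 (suc r) = trans (cong₂ _+_ (δ-refl (suc r)) (*-zeroˡ (u (suc r)))) refl
    det-X : det (ℕ.suc n) X ≡ v zero * prod (d ∘ suc)
    det-X = trans (det-upper-triangular _ X lower≡0)
                  (cong (v zero *_) (prod-cong-≗ (λ r → trans (cong (_* d (suc r)) (δ-refl (suc r))) (*-identityˡ _))))
      where
      lower≡0 : ∀ i j → toℕ j ℕ.< toℕ i → X i j ≡ + 0
      lower≡0 zero    j ()
      lower≡0 (suc r) l l<i = trans (cong (_* d (suc r)) (δ-≢ (λ eq → ℕ.<-irrefl (cong toℕ (sym eq)) l<i))) (*-zeroˡ (d (suc r)))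

  det-diagonal+rank-one : ∀ n (d u v : Fin (ℕ.suc n) → ℤ) →
    det (ℕ.suc n) (λ i j → δ i j * d i + u i * v j) ≡ prod d + ∑[ j < ℕ.suc n ] (u j * v j * prod (d ∘ punchIn j))
  det-diagonal+rank-one ℕ.zero d u v = begin
    det 1 (λ i j → δ i j * d i + u i * v j)          ≡⟨ det-expand 0 (λ i j → δ i j * d i + u i * v j) ⟩
    + 1 * (δ {1} zero zero * d zero + u zero * v zero) * + 1 + + 0
      ≡⟨ cong (λ z → + 1 * (z * d zero + u zero * v zero) * + 1 + + 0) (δ-refl {1} zero) ⟩
    + 1 * (+ 1 * d zero + u zero * v zero) * + 1 + + 0
      ≡⟨ solve 3 (λ d u v → con (+ 1) :* (con (+ 1) :* d :+ u :* v) :* con (+ 1) :+ con (+ 0) := d :* con (+ 1) :+ (u :* v :* con (+ 1) :+ con (+ 0))) refl (d zero) (u zero) (v zero) ⟩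
    d zero * + 1 + (u zero * v zero * + 1 + + 0)     ∎
    where open ≡-Reasoning
  det-diagonal+rank-one (ℕ.suc n) d u v = begin
    det (ℕ.suc (ℕ.suc n)) M
      ≡⟨ det-cong (ℕ.suc (ℕ.suc n)) M≡ ⟩
    det (ℕ.suc (ℕ.suc n)) ((λ l → d zero * δ zero l + u zero * v l) ∷ R)
      ≡⟨ det-linear-first-row (ℕ.suc n) (δ zero) v R (d zero) (u zero) ⟩
    d zero * det (ℕ.suc (ℕ.suc n)) (δ zero ∷ R) + u zero * det (ℕ.suc (ℕ.suc n)) (v ∷ R)
      ≡⟨ cong₂ (λ a b → d zero * a + u zero * b) det[δ₀∷R] (det[v∷d+u⊗v] (ℕ.suc n) d u v) ⟩
    d zero * (P + S) + u zero * (v zero * P)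
      ≡⟨ solve 5 (λ d₀ P S u₀ v₀ → d₀ :* (P :+ S) :+ u₀ :* (v₀ :* P) := d₀ :* P :+ (u₀ :* v₀ :* P :+ d₀ :* S)) refl (d zero) P S (u zero) (v zero) ⟩
    d zero * P + (u zero * v zero * P + d zero * S)
      ≡⟨ cong (λ z → d zero * P + (u zero * v zero * P + z)) (*-distribˡ-sum (d zero) (λ j → u (suc j) * v (suc j) * prod (d ∘ suc ∘ punchIn j))) ⟩
    d zero * P + (u zero * v zero * P + ∑[ j < ℕ.suc n ] (d zero * (u (suc j) * v (suc j) * prod (d ∘ suc ∘ punchIn j))))
      ≡⟨ cong (λ z → d zero * P + (u zero * v zero * P + z)) (sum-cong-≗ (λ j → solve 4 (λ a b c p → a :* (b :* c :* p) := b :* c :* (a :* p)) refl (d zero) (u (suc j)) (v (suc j)) (prod (d ∘ suc ∘ punchIn j)))) ⟩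
    prod d + ∑[ j < ℕ.suc (ℕ.suc n) ] (u j * v j * prod (d ∘ punchIn j)) ∎
    where
    open ≡-Reasoning
    M : Matrix (ℕ.suc (ℕ.suc n))
    M i j = δ i j * d i + u i * v j
    R : Fin (ℕ.suc n) → Vector ℤ (ℕ.suc (ℕ.suc n))
    R r l = δ (suc r) l * d (suc r) + u (suc r) * v l
    P = prod (d ∘ suc)
    S = ∑[ j < ℕ.suc n ] (u (suc j) * v (suc j) * prod (d ∘ suc ∘ punchIn j))
    M≡ : ∀ i l → M i l ≡ ((λ l → d zero * δ zero l + u zero * v l) ∷ R) i l
    M≡ zero    l = cong (_+ u zero * v l) (*-comm (δ zero l) (d zero))
    M≡ (suc i) l = refl
    det[δ₀∷R] : det (ℕ.suc (ℕ.suc n)) (δ zero ∷ R) ≡ P + S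
    det[δ₀∷R] = begin
      det (ℕ.suc (ℕ.suc n)) (δ zero ∷ R)                       ≡⟨ det-single-entry (ℕ.suc n) (δ zero ∷ R) zero (λ j j≢0 → δ-≢ (j≢0 ∘ sym)) ⟩
      + 1 * δ {ℕ.suc (ℕ.suc n)} zero zero * det (ℕ.suc n) (minor zero (δ zero ∷ R))
        ≡⟨ trans (cong (λ z → + 1 * z * det (ℕ.suc n) (minor zero (δ zero ∷ R))) (δ-refl {ℕ.suc (ℕ.suc n)} zero)) (*-identityˡ _) ⟩
      det (ℕ.suc n) (minor zero (δ zero ∷ R))                   ≡⟨ det-cong (ℕ.suc n) (λ i j → cong (λ z → z * d (suc i) + u (suc i) * v (suc j)) (δ-punchIn zero i j)) ⟩
      det (ℕ.suc n) (λ i j → δ i j * d (suc i) + u (suc i) * v (suc j)) ≡⟨ det-diagonal+rank-one n (d ∘ suc) (u ∘ suc) (v ∘ suc) ⟩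
      P + S                                                      ∎

  det-similar : ∀ n (P M M′ : Matrix n) → det n P ≢ + 0 → (∀ i j → (P ∙ M) i j ≡ (M′ ∙ P) i j) → det n M ≡ det n M′
  det-similar n P M M′ det[P]≢0 PM≡M′P = *-cancelˡ-≡ (det n P) (det n M) (det n M′) {{≢-nonZero det[P]≢0}} (begin
    det n P * det n M      ≡⟨ det-∙ n P M ⟨
    det n (P ∙ M)          ≡⟨ det-cong n PM≡M′P ⟩
    det n (M′ ∙ P)         ≡⟨ det-∙ n M′ P ⟩
    det n M′ * det n P     ≡⟨ *-comm (det n M′) (det n P) ⟩
    det n P * det n M′     ∎)
    where open ≡-Reasoning

  similar-shift : ∀ {n} (P M M′ : Matrix n) a → (∀ i j → (P ∙ M) i j ≡ (M′ ∙ P) i j) →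
    ∀ i j → (P ∙ (λ r c → δ r c * a - M r c)) i j ≡ ((λ r c → δ r c * a - M′ r c) ∙ P) i j
  similar-shift {n} P M M′ a PM≡M′P i j = begin
    ∑[ l < n ] (P i l * (δ l j * a - M l j))                   ≡⟨ sum-cong-≗ {n} (λ l → solve 4 (λ p d a m → p :* (d :* a :- m) := p :* d :* a :+ (:- (p :* m))) refl (P i l) (δ l j) a (M l j)) ⟩
    ∑[ l < n ] (P i l * δ l j * a + - (P i l * M l j))         ≡⟨ ∑-distrib-+ (λ l → P i l * δ l j * a) (λ l → - (P i l * M l j)) ⟩
    ∑[ l < n ] (P i l * δ l j * a) + ∑[ l < n ] (- (P i l * M l j))
      ≡⟨ cong₂ _+_ (trans (sym (*-distribʳ-sum a (λ l → P i l * δ l j))) (cong (_* a) (sum-*δ j (P i)))) (sum-neg (λ l → P i l * M l j)) ⟩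
    P i j * a + - (P ∙ M) i j                                  ≡⟨ cong (λ z → P i j * a + - z) (PM≡M′P i j) ⟩
    P i j * a + - (M′ ∙ P) i j                                 ≡⟨ cong₂ (λ u v → u + - v) (trans (*-comm (P i j) a) (sym (sum-δ i (λ l → a * P l j)))) refl ⟩
    ∑[ l < n ] (δ i l * (a * P l j)) + - ∑[ l < n ] (M′ i l * P l j)
      ≡⟨ cong (_+_ (∑[ l < n ] (δ i l * (a * P l j)))) (sum-neg (λ l → M′ i l * P l j)) ⟨
    ∑[ l < n ] (δ i l * (a * P l j)) + ∑[ l < n ] (- (M′ i l * P l j))
      ≡⟨ ∑-distrib-+ (λ l → δ i l * (a * P l j)) (λ l → - (M′ i l * P l j)) ⟨
    ∑[ l < n ] (δ i l * (a * P l j) + - (M′ i l * P l j))      ≡⟨ sum-cong-≗ {n} (λ l → solve 4 (λ d a p m → d :* (a :* p) :+ (:- (m :* p)) := (d :* a :- m) :* p) refl (δ i l) a (P l j) (M′ i l)) ⟩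
    ∑[ l < n ] ((δ i l * a - M′ i l) * P l j)                  ∎
    where open ≡-Reasoning

  prod-scale : ∀ {n} c (f : Fin n → ℤ) → prod (λ i → c * f i) ≡ c ^ n * prod f
  prod-scale {ℕ.zero}  c f = refl
  prod-scale {ℕ.suc n} c f = trans (cong (c * f zero *_) (prod-scale c (f ∘ suc)))
    (solve 4 (λ c a p q → c :* a :* (p :* q) := (c :* p) :* (a :* q)) refl c (f zero) (c ^ n) (prod (f ∘ suc)))

  +[m^n]≡[+m]^n : ∀ m n → + (m ℕ.^ n) ≡ (+ m) ^ n
  +[m^n]≡[+m]^n m ℕ.zero    = refl
  +[m^n]≡[+m]^n m (ℕ.suc n) = trans (pos-* m (m ℕ.^ n)) (cong (+ m *_) (+[m^n]≡[+m]^n m n))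

  prod≢0 : ∀ {n} (f : Fin n → ℤ) → (∀ i → f i ≢ + 0) → prod f ≢ + 0
  prod≢0 {ℕ.zero}  f f≢0 ()
  prod≢0 {ℕ.suc n} f f≢0 eq with i*j≡0⇒i≡0∨j≡0 (f zero) eq
  ... | inj₁ f₀≡0 = f≢0 zero f₀≡0
  ... | inj₂ rest≡0 = prod≢0 (f ∘ suc) (f≢0 ∘ suc) rest≡0

  det≢0-if-lower-triangular : ∀ n (L : Matrix n) → (∀ i j → toℕ i ℕ.< toℕ j → L i j ≡ + 0) → (∀ i → L i i ≢ + 0) → det n L ≢ + 0
  det≢0-if-lower-triangular n L upper≡0 diagonal≢0 eq = prod≢0 (λ i → L i i) diagonal≢0 (trans (sym (det-lower-triangular n L upper≡0)) eq)

  +sumBelow≡∑ : ∀ n (g : ℕ → ℕ) → + sumBelow n g ≡ ∑[ i < n ] (+ g (toℕ i))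
  +sumBelow≡∑ ℕ.zero    g = refl
  +sumBelow≡∑ (ℕ.suc n) g = trans (pos-+ (g 0) _) (cong (_+_ (+ g 0)) (+sumBelow≡∑ n (g ∘ ℕ.suc)))

  sumTo≡∑ : ∀ n (f : ℕ → ℤ) → sumTo n f ≡ ∑[ i < n ] f (toℕ i)
  sumTo≡∑ ℕ.zero    f = refl
  sumTo≡∑ (ℕ.suc n) f = begin
    sumTo n f + f n                                    ≡⟨ cong (_+ f n) (sumTo≡∑ n f) ⟩
    ∑[ i < n ] f (toℕ i) + f n                         ≡⟨ snoc n f ⟩
    ∑[ i < ℕ.suc n ] f (toℕ i)                         ∎
    where
    open ≡-Reasoning
    snoc : ∀ n (f : ℕ → ℤ) → ∑[ i < n ] f (toℕ i) + f n ≡ ∑[ i < ℕ.suc n ] f (toℕ i)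
    snoc ℕ.zero    f = trans (+-identityˡ (f 0)) (sym (+-identityʳ (f 0)))
    snoc (ℕ.suc n) f = trans (+-assoc (f 0) _ (f (ℕ.suc n))) (cong (_+_ (f 0)) (snoc n (f ∘ ℕ.suc)))

  prodTo≡prod : ∀ n (f : ℕ → ℤ) → prodTo n f ≡ prod (λ (i : Fin n) → f (toℕ i))
  prodTo≡prod ℕ.zero    f = refl
  prodTo≡prod (ℕ.suc n) f = begin
    prodTo n f * f n                                   ≡⟨ cong (_* f n) (prodTo≡prod n f) ⟩
    prod (λ (i : Fin n) → f (toℕ i)) * f n             ≡⟨ snoc n f ⟩
    prod (λ (i : Fin (ℕ.suc n)) → f (toℕ i))           ∎
    where
    open ≡-Reasoning
    snoc : ∀ n (f : ℕ → ℤ) → prod (λ (i : Fin n) → f (toℕ i)) * f n ≡ prod (λ (i : Fin (ℕ.suc n)) → f (toℕ i))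
    snoc ℕ.zero    f = trans (*-identityˡ (f 0)) (sym (*-identityʳ (f 0)))
    snoc (ℕ.suc n) f = trans (*-assoc (f 0) _ (f (ℕ.suc n))) (cong (f 0 *_) (snoc n (f ∘ ℕ.suc)))

  if-≡ : ∀ i (a b : ℤ) → (if ⌊ i ℕ.≟ i ⌋ then a else b) ≡ a
  if-≡ i a b rewrite isYes≗does (i ℕ.≟ i) | dec-true (i ℕ.≟ i) refl = refl

  if-≢ : ∀ {i j} (a b : ℤ) → i ≢ j → (if ⌊ i ℕ.≟ j ⌋ then a else b) ≡ b
  if-≢ {i} {j} a b i≢j rewrite isYes≗does (i ℕ.≟ j) | dec-false (i ℕ.≟ j) i≢j = refl

  prod-except : ∀ {n} (e : Fin (ℕ.suc n) → ℤ) t → prod (λ i → if ⌊ toℕ i ℕ.≟ toℕ t ⌋ then + 1 else e i) ≡ prod (e ∘ punchIn t)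
  prod-except e t = begin
    prod (λ i → if ⌊ toℕ i ℕ.≟ toℕ t ⌋ then + 1 else e i)                   ≡⟨ prod-remove {i = t} (λ i → if ⌊ toℕ i ℕ.≟ toℕ t ⌋ then + 1 else e i) ⟩
    (if ⌊ toℕ t ℕ.≟ toℕ t ⌋ then + 1 else e t) * prod (λ i → if ⌊ toℕ (punchIn t i) ℕ.≟ toℕ t ⌋ then + 1 else e (punchIn t i))
      ≡⟨ cong₂ _*_ (if-≡ (toℕ t) (+ 1) (e t)) (prod-cong-≗ (λ i → if-≢ (+ 1) (e (punchIn t i)) (punchInᵢ≢i t i ∘ sym ∘ toℕ-injective ∘ sym))) ⟩
    + 1 * prod (e ∘ punchIn t)                                              ≡⟨ *-identityˡ _ ⟩
    prod (e ∘ punchIn t)                                                    ∎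
    where open ≡-Reasoning

  -- The truncated Holte matrix

  module Holte (n N : ℕ) .{{_ : NonZero N}} where

    k n₁ : ℕ
    k  = ℕ.suc (ℕ.suc n)
    n₁ = ℕ.suc n

    K : ℤ
    K = + (k !)

    T̃ : Matrix n₁
    T̃ = Ttilde k N

    lastRow : Fin n₁ → ℤ
    lastRow c = + ((N ℕ.+ toℕ c) C k)

    f : Fin n₁ → Poly
    f c = fallingPoly (+ toℕ c) k

    exponent : Fin n₁ → ℕ
    exponent t = k ℕ.∸ toℕ t

    P : Matrix n₁
    P t c = coeff (f c) (exponent t)

    s : ℕ → ℤ
    s m = + stirling1 k m

    c<k : ∀ (c : Fin n₁) → toℕ c ℕ.< k
    c<k c = ℕ.m<n⇒m<1+n (toℕ<n c)

    eval-f : ∀ c x → eval (f c) (+ x) ≡ + (k ! ℕ.* ((x ℕ.+ toℕ c) C k))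
    eval-f c x = trans (eval-fallingPoly (+ toℕ c) k (+ x)) (trans (cong (λ y → falling y k) (sym (pos-+ x (toℕ c)))) (falling≡!*C (x ℕ.+ toℕ c) k))

    coeff-f-high : ∀ c m → k ℕ.< m → coeff (f c) m ≡ + 0
    coeff-f-high c = coeff-fallingPoly-high (+ toℕ c) k

    f-eigen : ∀ c x → eval (∑ₚ n₁ (λ c′ → T̃ c′ c ⊛ f c′) ⊕ lastRow c ⊛ risingPoly k) (+ x) ≡ eval (dilate (+ N) (f c)) (+ x)
    f-eigen c x = begin
      eval (∑ₚ n₁ (λ c′ → T̃ c′ c ⊛ f c′) ⊕ lastRow c ⊛ risingPoly k) (+ x)
        ≡⟨ eval-⊕ (∑ₚ n₁ (λ c′ → T̃ c′ c ⊛ f c′)) (lastRow c ⊛ risingPoly k) (+ x) ⟩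
      eval (∑ₚ n₁ (λ c′ → T̃ c′ c ⊛ f c′)) (+ x) + eval (lastRow c ⊛ risingPoly k) (+ x)
        ≡⟨ cong₂ _+_ (trans (eval-∑ₚ n₁ (λ c′ → T̃ c′ c ⊛ f c′) (+ x)) (sum-cong-≗ {n₁} term≡))
                     (trans (eval-⊛ (lastRow c) (risingPoly k) (+ x)) (trans (cong (lastRow c *_) (eval-risingPoly (ℕ.suc n) x)) (reorder ((N ℕ.+ toℕ c) C k) ((x ℕ.+ n₁) C k)))) ⟩
      ∑[ c′ < n₁ ] (K * + g (toℕ c′)) + K * + last
        ≡⟨ cong (_+ K * + last) (*-distribˡ-sum {n₁} K (λ c′ → + g (toℕ c′))) ⟨
      K * ∑[ c′ < n₁ ] (+ g (toℕ c′)) + K * + last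
        ≡⟨ cong (λ z → K * z + K * + last) (+sumBelow≡∑ n₁ g) ⟨
      K * + sumBelow n₁ g + K * + last
        ≡⟨ *-distribˡ-+ K (+ sumBelow n₁ g) (+ last) ⟨
      K * (+ sumBelow n₁ g + + last)
        ≡⟨ cong (K *_) (trans (sym (pos-+ (sumBelow n₁ g) last)) (cong +_ eigen)) ⟩
      K * + ((N ℕ.* x ℕ.+ toℕ c) C k)
        ≡⟨ pos-* (k !) _ ⟨
      + (k ! ℕ.* ((N ℕ.* x ℕ.+ toℕ c) C k))
        ≡⟨ eval-f c (N ℕ.* x) ⟨
      eval (f c) (+ (N ℕ.* x))
        ≡⟨ trans (cong (eval (f c)) (pos-* N x)) (sym (eval-dilate (+ N) (f c) (+ x))) ⟩
      eval (dilate (+ N) (f c)) (+ x) ∎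
      where
      open ≡-Reasoning
      g : ℕ → ℕ
      g c′ = ((x ℕ.+ c′) C k) ℕ.* Tcount k N c′ (toℕ c)
      last = ((x ℕ.+ n₁) C k) ℕ.* ((N ℕ.+ toℕ c) C k)
      reorder : ∀ t b → + t * + (k ! ℕ.* b) ≡ K * + (b ℕ.* t)
      reorder t b = trans (sym (pos-* t _)) (trans (cong +_ (x∙yz≈y∙xz t (k !) b)) (trans (pos-* (k !) _) (cong (λ m → K * + m) (ℕ.*-comm t b))))
      term≡ : ∀ c′ → eval (T̃ c′ c ⊛ f c′) (+ x) ≡ K * + g (toℕ c′)
      term≡ c′ = trans (eval-⊛ (T̃ c′ c) (f c′) (+ x)) (trans (cong (T̃ c′ c *_) (eval-f c′ x)) (reorder (Tcount k N (toℕ c′) (toℕ c)) ((x ℕ.+ toℕ c′) C k)))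
      eigen : sumBelow n₁ g ℕ.+ last ≡ (N ℕ.* x ℕ.+ toℕ c) C k
      eigen = begin
        sumBelow n₁ g ℕ.+ last                   ≡⟨ cong (λ m → sumBelow n₁ g ℕ.+ ((x ℕ.+ n₁) C k) ℕ.* m) (Tcount-last N n₁ (toℕ c) (c<k c)) ⟨
        sumBelow n₁ g ℕ.+ g n₁                   ≡⟨ sumBelow-snoc n₁ g ⟨
        sumBelow k g                             ≡⟨ binomial-eigen N k x (toℕ c) (c<k c) ⟨
        (N ℕ.* x ℕ.+ toℕ c) C k                  ∎

    P-eigen : ∀ t c → ∑[ c′ < n₁ ] (T̃ c′ c * P t c′) + lastRow c * s (exponent t) ≡ (+ N) ^ exponent t * P t c
    P-eigen t c = begin
      ∑[ c′ < n₁ ] (T̃ c′ c * P t c′) + lastRow c * s (exponent t)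
        ≡⟨ cong₂ _+_ (trans (sum-cong-≗ {n₁} (λ c′ → sym (coeff-⊛ (T̃ c′ c) (f c′) (exponent t)))) (sym (coeff-∑ₚ n₁ (λ c′ → T̃ c′ c ⊛ f c′) (exponent t))))
                     (trans (cong (lastRow c *_) (sym (coeff-risingPoly k (exponent t)))) (sym (coeff-⊛ (lastRow c) (risingPoly k) (exponent t)))) ⟩
      coeff (∑ₚ n₁ (λ c′ → T̃ c′ c ⊛ f c′)) (exponent t) + coeff (lastRow c ⊛ risingPoly k) (exponent t)
        ≡⟨ coeff-⊕ (∑ₚ n₁ (λ c′ → T̃ c′ c ⊛ f c′)) (lastRow c ⊛ risingPoly k) (exponent t) ⟨
      coeff (∑ₚ n₁ (λ c′ → T̃ c′ c ⊛ f c′) ⊕ lastRow c ⊛ risingPoly k) (exponent t)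
        ≡⟨ eval≗⇒coeff≡ (∑ₚ n₁ (λ c′ → T̃ c′ c ⊛ f c′) ⊕ lastRow c ⊛ risingPoly k) (dilate (+ N) (f c)) (f-eigen c) (exponent t) ⟩
      coeff (dilate (+ N) (f c)) (exponent t)
        ≡⟨ coeff-dilate (+ N) (f c) (exponent t) ⟩
      (+ N) ^ exponent t * P t c ∎
      where open ≡-Reasoning

    K*lastRow : ∀ c → K * lastRow c ≡ ∑[ t < n₁ ] (P t c * ((+ N) ^ exponent t - + N))
    K*lastRow c = begin
      K * lastRow c
        ≡⟨ trans (sym (pos-* (k !) _)) (sym (eval-f c N)) ⟩
      eval (f c) (+ N)
        ≡⟨ eval≡low+∑top (f c) n (coeff-f-high c) (+ N) ⟩
      c₀ + c₁ * + N + ∑[ t < n₁ ] (P t c * (+ N) ^ exponent t)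
        ≡⟨ cong₂ (λ a b → a + b * + N + ∑[ t < n₁ ] (P t c * (+ N) ^ exponent t)) c₀≡0 c₁≡-∑P ⟩
      + 0 + - ∑P * + N + ∑[ t < n₁ ] (P t c * (+ N) ^ exponent t)
        ≡⟨ solve 3 (λ a N b → con (+ 0) :+ (:- a) :* N :+ b := b :+ (:- (a :* N))) refl ∑P (+ N) _ ⟩
      ∑[ t < n₁ ] (P t c * (+ N) ^ exponent t) + - (∑P * + N)
        ≡⟨ cong (λ z → ∑[ t < n₁ ] (P t c * (+ N) ^ exponent t) + - z) (*-distribʳ-sum (+ N) (λ t → P t c)) ⟩
      ∑[ t < n₁ ] (P t c * (+ N) ^ exponent t) + - ∑[ t < n₁ ] (P t c * + N)
        ≡⟨ cong (_+_ (∑[ t < n₁ ] (P t c * (+ N) ^ exponent t))) (sum-neg (λ t → P t c * + N)) ⟨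
      ∑[ t < n₁ ] (P t c * (+ N) ^ exponent t) + ∑[ t < n₁ ] (- (P t c * + N))
        ≡⟨ ∑-distrib-+ (λ t → P t c * (+ N) ^ exponent t) (λ t → - (P t c * + N)) ⟨
      ∑[ t < n₁ ] (P t c * (+ N) ^ exponent t + - (P t c * + N))
        ≡⟨ sum-cong-≗ {n₁} (λ t → solve 3 (λ p a N → p :* a :+ (:- (p :* N)) := p :* (a :- N)) refl (P t c) ((+ N) ^ exponent t) (+ N)) ⟩
      ∑[ t < n₁ ] (P t c * ((+ N) ^ exponent t - + N)) ∎
      where
      open ≡-Reasoning
      c₀ = coeff (f c) 0
      c₁ = coeff (f c) 1
      ∑P = ∑[ t < n₁ ] P t c
      c₀≡0 : c₀ ≡ + 0
      c₀≡0 = trans (sym (eval-at-0 (f c))) (trans (eval-f c 0) (cong +_ (trans (cong (k ! ℕ.*_) (k>n⇒nCk≡0 (c<k c))) (ℕ.*-zeroʳ (k !)))))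
      f[1]≡0 : eval (f c) (+ 1) ≡ + 0
      f[1]≡0 = trans (eval-f c 1) (cong +_ (trans (cong (k ! ℕ.*_) (k>n⇒nCk≡0 (ℕ.s≤s (toℕ<n c)))) (ℕ.*-zeroʳ (k !))))
      f[1]≡c₀+c₁+∑P : eval (f c) (+ 1) ≡ c₀ + c₁ + ∑P
      f[1]≡c₀+c₁+∑P = trans (eval≡low+∑top (f c) n (coeff-f-high c) (+ 1))
        (cong₂ _+_ (cong (_+_ c₀) (*-identityʳ c₁)) (sum-cong-≗ {n₁} (λ t → trans (cong (P t c *_) (^-zeroˡ (exponent t))) (*-identityʳ (P t c)))))
      c₁≡-∑P : c₁ ≡ - ∑P
      c₁≡-∑P = begin
        c₁                      ≡⟨ solve 3 (λ a b S → b := (a :+ b :+ S) :- S :- a) refl c₀ c₁ ∑P ⟩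
        (c₀ + c₁ + ∑P) - ∑P - c₀ ≡⟨ cong₂ (λ u v → u - ∑P - v) (trans (sym f[1]≡c₀+c₁+∑P) f[1]≡0) c₀≡0 ⟩
        + 0 - ∑P - + 0          ≡⟨ solve 1 (λ S → con (+ 0) :- S :- con (+ 0) := :- S) refl ∑P ⟩
        - ∑P                    ∎


    Kⁿ : ℤ
    Kⁿ = K ^ n

    Kⁿ≢0 : Kⁿ ≢ + 0
    Kⁿ≢0 Kⁿ≡0 = ℕ.<⇒≢ (ℕ.1≤n! k) (sym (+-injective (i^n≡0⇒i≡0 K n Kⁿ≡0)))

    Kⁿ*K*charPoly : ∀ x → Kⁿ * (K * charPoly n₁ T̃ x) ≡ det n₁ (λ i j → δ i j * (K * x) - K * T̃ i j)
    Kⁿ*K*charPoly x = begin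
      Kⁿ * (K * charPoly n₁ T̃ x)
        ≡⟨ solve 3 (λ a b c → a :* (b :* c) := b :* a :* c) refl Kⁿ K (charPoly n₁ T̃ x) ⟩
      K ^ n₁ * charPoly n₁ T̃ x
        ≡⟨ det-scale n₁ K (λ i j → (if ⌊ i Fin.≟ j ⌋ then x else + 0) - T̃ i j) ⟨
      det n₁ (λ i j → K * ((if ⌊ i Fin.≟ j ⌋ then x else + 0) - T̃ i j))
        ≡⟨ det-cong n₁ (λ i j → K[x-t]≡ ⌊ i Fin.≟ j ⌋ (T̃ i j)) ⟩
      det n₁ (λ i j → δ i j * (K * x) - K * T̃ i j) ∎
      where
      open ≡-Reasoning
      K[x-t]≡ : ∀ b t → K * ((if b then x else + 0) - t) ≡ (if b then + 1 else + 0) * (K * x) - K * t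
      K[x-t]≡ true  t = solve 3 (λ K x t → K :* (x :- t) := con (+ 1) :* (K :* x) :- K :* t) refl K x t
      K[x-t]≡ false t = solve 3 (λ K x t → K :* (con (+ 0) :- t) := con (+ 0) :* (K :* x) :- K :* t) refl K x t

    A : Matrix n₁
    A t t′ = δ t t′ * (K * (+ N) ^ exponent t) - s (exponent t) * ((+ N) ^ exponent t′ - + N)

    P∙KT̃≡A∙P : ∀ t c → (P ∙ (λ i j → K * T̃ i j)) t c ≡ (A ∙ P) t c
    P∙KT̃≡A∙P t c = begin
      ∑[ c′ < n₁ ] (P t c′ * (K * T̃ c′ c))
        ≡⟨ sum-cong-≗ {n₁} (λ c′ → solve 3 (λ p K T → p :* (K :* T) := K :* (T :* p)) refl (P t c′) K (T̃ c′ c)) ⟩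
      ∑[ c′ < n₁ ] (K * (T̃ c′ c * P t c′))
        ≡⟨ *-distribˡ-sum K (λ c′ → T̃ c′ c * P t c′) ⟨
      K * ∑[ c′ < n₁ ] (T̃ c′ c * P t c′)
        ≡⟨ cong (K *_) ∑T̃P≡ ⟩
      K * ((+ N) ^ exponent t * P t c - lastRow c * s (exponent t))
        ≡⟨ solve 5 (λ K a p L s → K :* (a :* p :- L :* s) := (K :* a) :* p :+ (:- (s :* (K :* L)))) refl K ((+ N) ^ exponent t) (P t c) (lastRow c) (s (exponent t)) ⟩
      K * (+ N) ^ exponent t * P t c + - (s (exponent t) * (K * lastRow c))
        ≡⟨ cong₂ (λ u v → u + - (s (exponent t) * v)) (sym (sum-δ t (λ t′ → K * (+ N) ^ exponent t * P t′ c))) (K*lastRow c) ⟩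
      ∑[ t′ < n₁ ] (δ t t′ * (K * (+ N) ^ exponent t * P t′ c)) + - (s (exponent t) * ∑[ t′ < n₁ ] (P t′ c * ((+ N) ^ exponent t′ - + N)))
        ≡⟨ cong (λ z → ∑[ t′ < n₁ ] (δ t t′ * (K * (+ N) ^ exponent t * P t′ c)) + - z) (*-distribˡ-sum (s (exponent t)) (λ t′ → P t′ c * ((+ N) ^ exponent t′ - + N))) ⟩
      ∑[ t′ < n₁ ] (δ t t′ * (K * (+ N) ^ exponent t * P t′ c)) + - ∑[ t′ < n₁ ] (s (exponent t) * (P t′ c * ((+ N) ^ exponent t′ - + N)))
        ≡⟨ cong (_+_ (∑[ t′ < n₁ ] (δ t t′ * (K * (+ N) ^ exponent t * P t′ c)))) (sum-neg (λ t′ → s (exponent t) * (P t′ c * ((+ N) ^ exponent t′ - + N)))) ⟨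
      ∑[ t′ < n₁ ] (δ t t′ * (K * (+ N) ^ exponent t * P t′ c)) + ∑[ t′ < n₁ ] (- (s (exponent t) * (P t′ c * ((+ N) ^ exponent t′ - + N))))
        ≡⟨ ∑-distrib-+ (λ t′ → δ t t′ * (K * (+ N) ^ exponent t * P t′ c)) (λ t′ → - (s (exponent t) * (P t′ c * ((+ N) ^ exponent t′ - + N)))) ⟨
      ∑[ t′ < n₁ ] (δ t t′ * (K * (+ N) ^ exponent t * P t′ c) + - (s (exponent t) * (P t′ c * ((+ N) ^ exponent t′ - + N))))
        ≡⟨ sum-cong-≗ {n₁} (λ t′ → solve 5 (λ d a p s v → d :* (a :* p) :+ (:- (s :* (p :* v))) := (d :* a :- s :* v) :* p) refl
             (δ t t′) (K * (+ N) ^ exponent t) (P t′ c) (s (exponent t)) ((+ N) ^ exponent t′ - + N)) ⟩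
      ∑[ t′ < n₁ ] (A t t′ * P t′ c) ∎
      where
      open ≡-Reasoning
      ∑T̃P≡ : ∑[ c′ < n₁ ] (T̃ c′ c * P t c′) ≡ (+ N) ^ exponent t * P t c - lastRow c * s (exponent t)
      ∑T̃P≡ = begin
        ∑[ c′ < n₁ ] (T̃ c′ c * P t c′)
          ≡⟨ solve 2 (λ X L → X := (X :+ L) :- L) refl (∑[ c′ < n₁ ] (T̃ c′ c * P t c′)) (lastRow c * s (exponent t)) ⟩
        ∑[ c′ < n₁ ] (T̃ c′ c * P t c′) + lastRow c * s (exponent t) - lastRow c * s (exponent t)
          ≡⟨ cong (_- lastRow c * s (exponent t)) (P-eigen t c) ⟩
        (+ N) ^ exponent t * P t c - lastRow c * s (exponent t) ∎

    -- Vandermonde's identity expands f c in the G i, so P is a lower triangular matrix times the Pascal matrix.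
    G : Fin n₁ → Poly
    G i = falling (+ k) (toℕ i) ⊛ fallingPoly (+ 0) (k ℕ.∸ toℕ i)

    pascal : Matrix n₁
    pascal i c = + (toℕ c C toℕ i)

    S : Matrix n₁
    S t i = coeff (G i) (exponent t)

    eval-G : ∀ i x → eval (G i) (+ x) ≡ K * + (x C (k ℕ.∸ toℕ i))
    eval-G i x = begin
      eval (G i) (+ x)                                                  ≡⟨ eval-⊛ (falling (+ k) (toℕ i)) (fallingPoly (+ 0) (k ℕ.∸ toℕ i)) (+ x) ⟩
      falling (+ k) (toℕ i) * eval (fallingPoly (+ 0) (k ℕ.∸ toℕ i)) (+ x) ≡⟨ cong (falling (+ k) (toℕ i) *_) (trans (eval-fallingPoly (+ 0) (k ℕ.∸ toℕ i) (+ x))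
                                                                             (trans (cong (λ y → falling y (k ℕ.∸ toℕ i)) (+-identityʳ (+ x))) (falling≡!*C x (k ℕ.∸ toℕ i)))) ⟩
      falling (+ k) (toℕ i) * + ((k ℕ.∸ toℕ i) ! ℕ.* (x C (k ℕ.∸ toℕ i)))  ≡⟨ cong (falling (+ k) (toℕ i) *_) (pos-* ((k ℕ.∸ toℕ i) !) _) ⟩
      falling (+ k) (toℕ i) * (+ ((k ℕ.∸ toℕ i) !) * + (x C (k ℕ.∸ toℕ i))) ≡⟨ *-assoc (falling (+ k) (toℕ i)) _ _ ⟨
      falling (+ k) (toℕ i) * + ((k ℕ.∸ toℕ i) !) * + (x C (k ℕ.∸ toℕ i))   ≡⟨ cong (_* + (x C (k ℕ.∸ toℕ i))) (falling*! k (toℕ i) (ℕ.<⇒≤ (c<k i))) ⟩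
      K * + (x C (k ℕ.∸ toℕ i))                                          ∎
      where open ≡-Reasoning

    f≗∑pascal⊛G : ∀ c x → eval (f c) (+ x) ≡ eval (∑ₚ n₁ (λ i → pascal i c ⊛ G i)) (+ x)
    f≗∑pascal⊛G c x = begin
      eval (f c) (+ x)                                         ≡⟨ trans (eval-f c x) (pos-* (k !) _) ⟩
      K * + ((x ℕ.+ toℕ c) C k)                                ≡⟨ cong (λ m → K * + m) vandermonde ⟩
      K * + sumBelow n₁ g                                      ≡⟨ cong (K *_) (+sumBelow≡∑ n₁ g) ⟩
      K * ∑[ i < n₁ ] (+ g (toℕ i))                            ≡⟨ *-distribˡ-sum {n₁} K (λ i → + g (toℕ i)) ⟩
      ∑[ i < n₁ ] (K * + g (toℕ i))                            ≡⟨ sum-cong-≗ {n₁} (λ i → sym (term≡ i)) ⟩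
      ∑[ i < n₁ ] eval (pascal i c ⊛ G i) (+ x)                ≡⟨ eval-∑ₚ n₁ (λ i → pascal i c ⊛ G i) (+ x) ⟨
      eval (∑ₚ n₁ (λ i → pascal i c ⊛ G i)) (+ x)              ∎
      where
      open ≡-Reasoning
      g : ℕ → ℕ
      g i = (toℕ c C i) ℕ.* (x C (k ℕ.∸ i))
      vandermonde : (x ℕ.+ toℕ c) C k ≡ sumBelow n₁ g
      vandermonde = begin
        (x ℕ.+ toℕ c) C k          ≡⟨ C-vandermonde (toℕ c) x k ⟩
        sumBelow (2 ℕ.+ n₁) g      ≡⟨ cong (λ m → sumBelow m g) (ℕ.+-comm 2 n₁) ⟩
        sumBelow (n₁ ℕ.+ 2) g      ≡⟨ sumBelow-truncate n₁ 2 g (λ i n₁≤i → cong (ℕ._* (x C (k ℕ.∸ i))) (k>n⇒nCk≡0 (ℕ.<-≤-trans (toℕ<n c) n₁≤i))) ⟩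
        sumBelow n₁ g              ∎
      term≡ : ∀ i → eval (pascal i c ⊛ G i) (+ x) ≡ K * + g (toℕ i)
      term≡ i = begin
        eval (pascal i c ⊛ G i) (+ x)                              ≡⟨ trans (eval-⊛ (pascal i c) (G i) (+ x)) (cong (pascal i c *_) (eval-G i x)) ⟩
        + (toℕ c C toℕ i) * (K * + (x C (k ℕ.∸ toℕ i)))            ≡⟨ solve 3 (λ a b c → a :* (b :* c) := b :* (a :* c)) refl (+ (toℕ c C toℕ i)) K (+ (x C (k ℕ.∸ toℕ i))) ⟩
        K * (+ (toℕ c C toℕ i) * + (x C (k ℕ.∸ toℕ i)))            ≡⟨ cong (K *_) (pos-* (toℕ c C toℕ i) _) ⟨
        K * + g (toℕ i)                                            ∎

    P≡S∙pascal : ∀ t c → P t c ≡ (S ∙ pascal) t c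
    P≡S∙pascal t c = begin
      coeff (f c) (exponent t)                                    ≡⟨ eval≗⇒coeff≡ (f c) (∑ₚ n₁ (λ i → pascal i c ⊛ G i)) (f≗∑pascal⊛G c) (exponent t) ⟩
      coeff (∑ₚ n₁ (λ i → pascal i c ⊛ G i)) (exponent t)          ≡⟨ coeff-∑ₚ n₁ (λ i → pascal i c ⊛ G i) (exponent t) ⟩
      ∑[ i < n₁ ] coeff (pascal i c ⊛ G i) (exponent t)            ≡⟨ sum-cong-≗ {n₁} (λ i → trans (coeff-⊛ (pascal i c) (G i) (exponent t)) (*-comm (pascal i c) (S t i))) ⟩
      ∑[ i < n₁ ] (S t i * pascal i c)                          ∎
      where open ≡-Reasoning

    det-P≢0 : det n₁ P ≢ + 0
    det-P≢0 det[P]≡0 = det≢0-if-lower-triangular n₁ S S-upper≡0 S-diagonal≢0 (begin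
      det n₁ S                          ≡⟨ *-identityʳ (det n₁ S) ⟨
      det n₁ S * + 1                    ≡⟨ cong (det n₁ S *_) det-pascal ⟨
      det n₁ S * det n₁ pascal          ≡⟨ det-∙ n₁ S pascal ⟨
      det n₁ (S ∙ pascal)               ≡⟨ det-cong n₁ P≡S∙pascal ⟨
      det n₁ P                          ≡⟨ det[P]≡0 ⟩
      + 0                               ∎)
      where
      open ≡-Reasoning
      det-pascal : det n₁ pascal ≡ + 1
      det-pascal = trans (det-upper-triangular n₁ pascal (λ i c c<i → cong +_ (k>n⇒nCk≡0 c<i)))
                         (trans (prod-cong-≗ {n₁} (λ i → cong +_ (nCn≡1 (toℕ i)))) (prod-replicate-one n₁))
      S-upper≡0 : ∀ t i → toℕ t ℕ.< toℕ i → S t i ≡ + 0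
      S-upper≡0 t i t<i = trans (coeff-⊛ (falling (+ k) (toℕ i)) (fallingPoly (+ 0) (k ℕ.∸ toℕ i)) (exponent t))
        (trans (cong (falling (+ k) (toℕ i) *_) (coeff-fallingPoly-high (+ 0) (k ℕ.∸ toℕ i) (exponent t) (ℕ.∸-monoʳ-< t<i (ℕ.<⇒≤ (c<k i)))))
               (*-zeroʳ (falling (+ k) (toℕ i))))
      S-diagonal≢0 : ∀ i → S i i ≢ + 0
      S-diagonal≢0 i S[i,i]≡0 = ℕ.<⇒≢ (ℕ.*-mono-≤ (ℕ.1≤n! (toℕ i)) (C-pos k (toℕ i) (ℕ.<⇒≤ (c<k i)))) (sym (+-injective (begin
        + (toℕ i ! ℕ.* (k C toℕ i))                                          ≡⟨ falling≡!*C k (toℕ i) ⟨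
        falling (+ k) (toℕ i)                                                ≡⟨ *-identityʳ _ ⟨
        falling (+ k) (toℕ i) * + 1                                          ≡⟨ cong (falling (+ k) (toℕ i) *_) (coeff-fallingPoly-top (+ 0) (k ℕ.∸ toℕ i)) ⟨
        falling (+ k) (toℕ i) * coeff (fallingPoly (+ 0) (k ℕ.∸ toℕ i)) (exponent i) ≡⟨ coeff-⊛ (falling (+ k) (toℕ i)) (fallingPoly (+ 0) (k ℕ.∸ toℕ i)) (exponent i) ⟨
        S i i                                                                ≡⟨ S[i,i]≡0 ⟩
        + 0                                                                  ∎)))

    det[Kx-KT̃]≡det[Kx-A] : ∀ x → det n₁ (λ i j → δ i j * (K * x) - K * T̃ i j) ≡ det n₁ (λ i j → δ i j * (K * x) - A i j)
    det[Kx-KT̃]≡det[Kx-A] x = det-similar n₁ P (λ i j → δ i j * (K * x) - K * T̃ i j) (λ i j → δ i j * (K * x) - A i j) det-P≢0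
      (similar-shift P (λ i j → K * T̃ i j) A (K * x) P∙KT̃≡A∙P)

    -- The rising factorial at 1: ∑ₘ |s(k, m)| = k!, and |s(k, 0)| = 0.
    K≡∑s : K ≡ s 1 + ∑[ t < n₁ ] s (exponent t)
    K≡∑s = begin
      K                                                    ≡⟨ cong +_ (trans (cong (k ! ℕ.*_) (nCn≡1 k)) (ℕ.*-identityʳ (k !))) ⟨
      + (k ! ℕ.* ((1 ℕ.+ n₁) C k))                         ≡⟨ eval-risingPoly n₁ 1 ⟨
      eval (risingPoly k) (+ 1)                            ≡⟨ eval≡low+∑top (risingPoly k) n high≡0 (+ 1) ⟩
      coeff (risingPoly k) 0 + coeff (risingPoly k) 1 * + 1 + ∑[ t < n₁ ] (coeff (risingPoly k) (exponent t) * (+ 1) ^ exponent t)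
        ≡⟨ cong₂ (λ a b → a + b + ∑[ t < n₁ ] (coeff (risingPoly k) (exponent t) * (+ 1) ^ exponent t)) (trans (coeff-risingPoly k 0) (cong +_ (stirling1-suc-zero n₁))) (trans (*-identityʳ _) (coeff-risingPoly k 1)) ⟩
      + 0 + s 1 + ∑[ t < n₁ ] (coeff (risingPoly k) (exponent t) * (+ 1) ^ exponent t)
        ≡⟨ cong₂ _+_ (+-identityˡ (s 1)) (sum-cong-≗ {n₁} (λ t → trans (cong₂ _*_ (coeff-risingPoly k (exponent t)) (^-zeroˡ (exponent t))) (*-identityʳ (s (exponent t))))) ⟩
      s 1 + ∑[ t < n₁ ] s (exponent t)                        ∎
      where
      open ≡-Reasoning
      high≡0 : ∀ m → k ℕ.< m → coeff (risingPoly k) m ≡ + 0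
      high≡0 m k<m = trans (coeff-risingPoly k m) (cong +_ (stirling1-high k m k<m))

    module _ (x : ℤ) where

      e v : Fin n₁ → ℤ
      e t = x - (+ N) ^ exponent t
      v t = (+ N) ^ exponent t - + N

      rank-one-value : ℤ
      rank-one-value = K * prod e + ∑[ t < n₁ ] (s (exponent t) * v t * prod (e ∘ punchIn t))

      det[Kx-A] : det n₁ (λ t t′ → δ t t′ * (K * x) - A t t′) ≡ Kⁿ * rank-one-value
      det[Kx-A] = begin
        det n₁ (λ t t′ → δ t t′ * (K * x) - A t t′)
          ≡⟨ det-cong n₁ (λ t t′ → solve 6 (λ d K x a s w → d :* (K :* x) :- (d :* (K :* a) :- s :* w) := d :* (K :* (x :- a)) :+ s :* w) refl
               (δ t t′) K x ((+ N) ^ exponent t) (s (exponent t)) (v t′)) ⟩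
        det n₁ (λ t t′ → δ t t′ * (K * e t) + s (exponent t) * v t′)
          ≡⟨ det-diagonal+rank-one n (λ t → K * e t) (s ∘ exponent) v ⟩
        prod (λ t → K * e t) + ∑[ t < n₁ ] (s (exponent t) * v t * prod (λ i → K * e (punchIn t i)))
          ≡⟨ cong₂ _+_ (prod-scale K e) (sum-cong-≗ {n₁} (λ t → cong (s (exponent t) * v t *_) (prod-scale K (e ∘ punchIn t)))) ⟩
        K ^ n₁ * prod e + ∑[ t < n₁ ] (s (exponent t) * v t * (K ^ n * prod (e ∘ punchIn t)))
          ≡⟨ cong (_+_ (K ^ n₁ * prod e)) (trans (sum-cong-≗ {n₁} (λ t → solve 3 (λ a b c → a :* (b :* c) := b :* (a :* c)) refl (s (exponent t) * v t) (K ^ n) (prod (e ∘ punchIn t)))) (sym (*-distribˡ-sum {n₁} (K ^ n) (λ t → s (exponent t) * v t * prod (e ∘ punchIn t))))) ⟩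
        K ^ n₁ * prod e + K ^ n * ∑[ t < n₁ ] (s (exponent t) * v t * prod (e ∘ punchIn t))
          ≡⟨ solve 4 (λ K Kⁿ p S → K :* Kⁿ :* p :+ Kⁿ :* S := Kⁿ :* (K :* p :+ S)) refl K (K ^ n) (prod e) (∑[ t < n₁ ] (s (exponent t) * v t * prod (e ∘ punchIn t))) ⟩
        Kⁿ * rank-one-value ∎
        where open ≡-Reasoning

      factor : ℕ → ℕ → ℤ
      factor j i = if ⌊ i ℕ.≟ j ⌋ then + 1 else (x - + (N ℕ.^ (k ℕ.∸ i)))

      stated-sum≡rank-one-value : sumTo k (λ j → + stirling1 k (k ℕ.∸ j) * prodTo k (factor j)) ≡ rank-one-value
      stated-sum≡rank-one-value = begin
        sumTo n₁ term + term n₁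
          ≡⟨ cong₂ _+_ (trans (sumTo≡∑ n₁ term) (sum-cong-≗ {n₁} term-below)) term-last ⟩
        ∑[ t < n₁ ] (s (exponent t) * (prod (e ∘ punchIn t) * (x - + N))) + s 1 * prod e
          ≡⟨ cong (_+ s 1 * prod e) (sum-cong-≗ {n₁} split) ⟩
        ∑[ t < n₁ ] (s (exponent t) * prod e + s (exponent t) * v t * prod (e ∘ punchIn t)) + s 1 * prod e
          ≡⟨ cong (_+ s 1 * prod e) (∑-distrib-+ (λ t → s (exponent t) * prod e) (λ t → s (exponent t) * v t * prod (e ∘ punchIn t))) ⟩
        ∑[ t < n₁ ] (s (exponent t) * prod e) + ∑[ t < n₁ ] (s (exponent t) * v t * prod (e ∘ punchIn t)) + s 1 * prod e
          ≡⟨ cong (λ z → z + ∑[ t < n₁ ] (s (exponent t) * v t * prod (e ∘ punchIn t)) + s 1 * prod e) (*-distribʳ-sum (prod e) (s ∘ exponent)) ⟨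
        ∑[ t < n₁ ] s (exponent t) * prod e + ∑[ t < n₁ ] (s (exponent t) * v t * prod (e ∘ punchIn t)) + s 1 * prod e
          ≡⟨ solve 4 (λ Σs p R s₁ → Σs :* p :+ R :+ s₁ :* p := (s₁ :+ Σs) :* p :+ R) refl (∑[ t < n₁ ] s (exponent t)) (prod e) (∑[ t < n₁ ] (s (exponent t) * v t * prod (e ∘ punchIn t))) (s 1) ⟩
        (s 1 + ∑[ t < n₁ ] s (exponent t)) * prod e + ∑[ t < n₁ ] (s (exponent t) * v t * prod (e ∘ punchIn t))
          ≡⟨ cong (λ z → z * prod e + ∑[ t < n₁ ] (s (exponent t) * v t * prod (e ∘ punchIn t))) K≡∑s ⟨
        rank-one-value ∎
        where
        open ≡-Reasoning
        term : ℕ → ℤ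
        term j = + stirling1 k (k ℕ.∸ j) * prodTo k (factor j)
        x-N^[k-i]≡e : ∀ (i : Fin n₁) → x - + (N ℕ.^ (k ℕ.∸ toℕ i)) ≡ e i
        x-N^[k-i]≡e i = cong (_-_ x) (+[m^n]≡[+m]^n N (exponent i))
        last-factor : ∀ (t : Fin n₁) → factor (toℕ t) n₁ ≡ x - + N
        last-factor t = trans (if-≢ (+ 1) _ (λ n₁≡t → ℕ.<-irrefl (sym n₁≡t) (toℕ<n t)))
                              (trans (cong (λ m → x - + (N ℕ.^ m)) (ℕ.m+n∸n≡m 1 n)) (cong (λ m → x - + m) (ℕ.*-identityʳ N)))
        term-below : ∀ t → term (toℕ t) ≡ s (exponent t) * (prod (e ∘ punchIn t) * (x - + N))
        term-below t = cong (s (exponent t) *_) (cong₂ _*_ (begin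
          prodTo n₁ (factor (toℕ t))                              ≡⟨ prodTo≡prod n₁ (factor (toℕ t)) ⟩
          prod (λ (i : Fin n₁) → factor (toℕ t) (toℕ i))          ≡⟨ prod-cong-≗ {n₁} (λ i → cong (λ z → if ⌊ toℕ i ℕ.≟ toℕ t ⌋ then + 1 else z) (x-N^[k-i]≡e i)) ⟩
          prod (λ i → if ⌊ toℕ i ℕ.≟ toℕ t ⌋ then + 1 else e i)   ≡⟨ prod-except e t ⟩
          prod (e ∘ punchIn t)                                    ∎) (last-factor t))
        term-last : term n₁ ≡ s 1 * prod e
        term-last = cong₂ _*_ (cong (λ m → + stirling1 k m) (ℕ.m+n∸n≡m 1 n)) (begin
          prodTo n₁ (factor n₁) * factor n₁ n₁               ≡⟨ cong₂ _*_ (prodTo≡prod n₁ (factor n₁)) (if-≡ n₁ (+ 1) _) ⟩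
          prod (λ (i : Fin n₁) → factor n₁ (toℕ i)) * + 1    ≡⟨ *-identityʳ _ ⟩
          prod (λ (i : Fin n₁) → factor n₁ (toℕ i))          ≡⟨ prod-cong-≗ {n₁} (λ i → trans (if-≢ (+ 1) _ (λ i≡n₁ → ℕ.<-irrefl i≡n₁ (toℕ<n i))) (x-N^[k-i]≡e i)) ⟩
          prod e                                             ∎)
        split : ∀ t → s (exponent t) * (prod (e ∘ punchIn t) * (x - + N)) ≡ s (exponent t) * prod e + s (exponent t) * v t * prod (e ∘ punchIn t)
        split t = begin
          s (exponent t) * (prod (e ∘ punchIn t) * (x - + N))
            ≡⟨ solve 5 (λ u p x a N → u :* (p :* (x :- N)) := u :* ((x :- a) :* p) :+ u :* (a :- N) :* p) refl (s (exponent t)) (prod (e ∘ punchIn t)) x ((+ N) ^ exponent t) (+ N) ⟩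
          s (exponent t) * (e t * prod (e ∘ punchIn t)) + s (exponent t) * v t * prod (e ∘ punchIn t)
            ≡⟨ cong (λ z → s (exponent t) * z + s (exponent t) * v t * prod (e ∘ punchIn t)) (prod-remove {i = t} e) ⟨
          s (exponent t) * prod e + s (exponent t) * v t * prod (e ∘ punchIn t) ∎

open import Data.Integer using (ℤ; +_; _*_; _-_; ≢-nonZero)
open import Data.Integer.Properties using (*-cancelˡ-≡)
open import Data.Nat using (ℕ; NonZero; _≤_; _∸_; _^_; _!; _≟_; suc; s≤s)

proposition5p3 : (k N : ℕ) .{{_ : NonZero N}} → 2 ≤ k → 2 ≤ N → (x : ℤ) →
    (+ (k !)) * charPoly (k ∸ 1) (Ttilde k N) x
      ≡ sumTo k (λ j → (+ stirling1 k (k ∸ j))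
          * prodTo k (λ i → if ⌊ i ≟ j ⌋ then + 1 else (x - + (N ^ (k ∸ i)))))
proposition5p3 (suc (suc n)) N _ _ x = *-cancelˡ-≡ Kⁿ _ _ {{≢-nonZero Kⁿ≢0}} (begin
  Kⁿ * (K * charPoly n₁ T̃ x)                     ≡⟨ Kⁿ*K*charPoly x ⟩
  det n₁ (λ i j → δ i j * (K * x) - K * T̃ i j)   ≡⟨ det[Kx-KT̃]≡det[Kx-A] x ⟩
  det n₁ (λ i j → δ i j * (K * x) - A i j)       ≡⟨ det[Kx-A] x ⟩
  Kⁿ * rank-one-value x                          ≡⟨ cong (Kⁿ *_) (stated-sum≡rank-one-value x) ⟨
  Kⁿ * sumTo k (λ j → + stirling1 k (k ∸ j) * prodTo k (factor x j)) ∎)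
  where
  open ≡-Reasoning
  open Holte n N
proposition5p3 (suc 0) N (s≤s ()) _ x
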